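{- Let $m>0$ be an odd integer with $m\neq 3$. Then \[ \frac{2}{m+1}\sum_{r=0}^{m}\sum_{\lambda=0}^{m-r}\frac{\binom{m+1}{r}\binom{m+1-r}{\lambda}}{m+1-r}B_rB_{\lambda}B_{m-r-\lambda}+\frac{1}{m+1}\sum_{r=0}^{m-1}\binom{m+1}{r}B_rB_{m-1-r} =-\frac{m+2}{2m}\sum_{r=0}^{m-1}\binom{m}{r}B_{r}B_{m-1-r}+\frac{1}{4}\sum_{r=0}^{m-1}B_rB_{m-1-r}. \]
   Context: $B_0,B_1,B_2,\dots$ are the Bernoulli numbers defined by $B_0=1$ and $\sum_{k=0}^n\binom{n+1}{k}B_k=0$ for $n\ge1$ (so $B_1=-1/2$). -}

module Defs where

open import Data.Nat as ℕ using (ℕ; zero; suc; _≤ᵇ_)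
open import Data.Nat.Combinatorics using (_C_)
open import Data.Integer using (+_)
open import Data.Rational using (ℚ; 0ℚ; 1ℚ; _+_; _*_; -_; _/_)
open import Data.Bool using (if_then_else_)

sumTo : ℕ → (ℕ → ℚ) → ℚ
sumTo zero    f = f 0
sumTo (suc n) f = sumTo n f + f (suc n)

ι : ℕ → ℚ
ι n = (+ n) / 1

-- Bernoulli table: bernTable n k = B_k for k ≤ n.
-- B_0 = 1 and, for n ≥ 1, Σ_{k=0}^{n} C(n+1,k) B_k = 0, i.e.
-- B_n = - (1/(n+1)) Σ_{k=0}^{n-1} C(n+1,k) B_k.
bernTable : ℕ → ℕ → ℚ
bernTable zero    k = 1ℚ
bernTable (suc n) k =
  if k ≤ᵇ n then bernTable n k
  else - ((+ 1 / suc (suc n)) * sumTo n (λ j → ι (suc (suc n) C j) * bernTable n j))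

-- The Bernoulli number B_n (so B_1 = -1/2).
B : ℕ → ℚ
B n = bernTable n n

module Submission where

-- For m = 1 this is a computation; otherwise m = 2j + 5 and the proof rests on two facts:
--   (1) Bₖ = 0 for odd k ≥ 3, and
--   (2) if B_{M-1} = 0 then (M+2) Σ_{a≤M} Bₐ B_{M-a} = 2 Σ_{a≤M} C(M+2,a) Bₐ B_{M-a}.
-- Both are read off generating functions.  By (1), a product
-- B_r B_l B_k with r + l + k = m survives only if exactly one index is 1, so TripleSum collapses
-- the triple sum to single sums, and Assembly concludes with (2) and rational arithmetic.

open import Algebra using (CommutativeRing)
open import Relation.Binary.PropositionalEquality as P using (_≡_; _≢_)
open import Data.Nat as ℕ using (ℕ; zero; suc; _∸_; _≤_; _<_; z≤n; s≤s; NonZero; _%_)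
import Data.Nat.Properties as ℕP
open import Data.Nat.Combinatorics using (_C_; nCk+nC[k+1]≡[n+1]C[k+1]; nCk≡nC[n∸k]; k>n⇒nCk≡0; nC1≡n)
open import Data.Product using (_,_)
open import Data.Sum using ([_,_]′)
open import Data.Empty using (⊥-elim)
open import Relation.Nullary using (yes; no)
open import Data.Rational using (ℚ; 0ℚ)
open import Defs

module FiniteSums {c ℓ} (R : CommutativeRing c ℓ) where

  open CommutativeRing R hiding (zero)
  open import Relation.Binary.Reasoning.Setoid setoid
  open import Algebra.Properties.CommutativeSemigroup +-commutativeSemigroup using (interchange; xy∙z≈zx∙y)
  open import Algebra.Properties.Semiring.Mult semiring using (_×_; ×-homo-+; ×1-homo-*)

  Σ : ℕ → (ℕ → Carrier) → Carrier
  Σ zero    f = f 0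
  Σ (suc n) f = Σ n f + f (suc n)

  Σ-cong : ∀ n {f g} → (∀ k → k ≤ n → f k ≈ g k) → Σ n f ≈ Σ n g
  Σ-cong zero    eq = eq 0 z≤n
  Σ-cong (suc n) eq = +-cong (Σ-cong n (λ k k≤n → eq k (ℕP.m≤n⇒m≤1+n k≤n))) (eq (suc n) ℕP.≤-refl)

  Σ-cong′ : ∀ n {f g} → (∀ k → f k ≈ g k) → Σ n f ≈ Σ n g
  Σ-cong′ n eq = Σ-cong n (λ k _ → eq k)

  Σ-+ : ∀ n f g → Σ n (λ k → f k + g k) ≈ Σ n f + Σ n g
  Σ-+ zero    f g = refl
  Σ-+ (suc n) f g = trans (+-congʳ (Σ-+ n f g)) (interchange _ _ _ _)

  Σ-*ˡ : ∀ n a f → a * Σ n f ≈ Σ n (λ k → a * f k)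
  Σ-*ˡ zero    a f = refl
  Σ-*ˡ (suc n) a f = trans (distribˡ a _ _) (+-congʳ (Σ-*ˡ n a f))

  Σ-*ʳ : ∀ n a f → Σ n f * a ≈ Σ n (λ k → f k * a)
  Σ-*ʳ zero    a f = refl
  Σ-*ʳ (suc n) a f = trans (distribʳ a _ _) (+-congʳ (Σ-*ʳ n a f))

  Σ-0 : ∀ n f → (∀ k → k ≤ n → f k ≈ 0#) → Σ n f ≈ 0#
  Σ-0 n f eq = trans (Σ-cong n eq) (zeros n)
    where
    zeros : ∀ n → Σ n (λ _ → 0#) ≈ 0#
    zeros zero    = refl
    zeros (suc n) = trans (+-congʳ (zeros n)) (+-identityˡ 0#)

  Σ-first : ∀ n f → Σ (suc n) f ≈ f 0 + Σ n (λ k → f (suc k))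
  Σ-first zero    f = refl
  Σ-first (suc n) f = trans (+-congʳ (Σ-first n f)) (+-assoc _ _ _)

  Σ-last0 : ∀ n f → f (suc n) ≈ 0# → Σ (suc n) f ≈ Σ n f
  Σ-last0 n f eq = trans (+-congˡ eq) (+-identityʳ _)

  Σ-swap : ∀ n m (f : ℕ → ℕ → Carrier) →
           Σ n (λ i → Σ m (λ j → f i j)) ≈ Σ m (λ j → Σ n (λ i → f i j))
  Σ-swap zero    m f = refl
  Σ-swap (suc n) m f = trans (+-congʳ (Σ-swap n m f)) (sym (Σ-+ m _ _))

  Σ-extend : ∀ n m f → n ≤ m → (∀ k → n < k → f k ≈ 0#) → Σ m f ≈ Σ n f
  Σ-extend n m f n≤m eq with ℕP.m≤n⇒∃[o]m+o≡n n≤m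
  ... | d , P.refl = go d
    where
    go : ∀ d → Σ (n ℕ.+ d) f ≈ Σ n f
    go zero    = reflexive (P.cong (λ x → Σ x f) (ℕP.+-identityʳ n))
    go (suc d) = begin
      Σ (n ℕ.+ suc d) f    ≡⟨ P.cong (λ x → Σ x f) (ℕP.+-suc n d) ⟩
      Σ (suc (n ℕ.+ d)) f  ≈⟨ Σ-last0 (n ℕ.+ d) f (eq _ (s≤s (ℕP.m≤m+n n d))) ⟩
      Σ (n ℕ.+ d) f        ≈⟨ go d ⟩
      Σ n f                ∎

  Σ-single : ∀ n j f → j ≤ n → (∀ k → k ≤ n → k ≢ j → f k ≈ 0#) → Σ n f ≈ f j
  Σ-single zero    .zero f z≤n eq = refl
  Σ-single (suc n) j    f j≤  eq with j ℕ.≟ suc n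
  ... | yes P.refl = trans (+-congʳ (Σ-0 n f (λ k k≤n → eq k (ℕP.m≤n⇒m≤1+n k≤n) (ℕP.<⇒≢ (s≤s k≤n)))))
                           (+-identityˡ _)
  ... | no  j≢     = trans (Σ-last0 n f (eq (suc n) ℕP.≤-refl (λ e → j≢ (P.sym e))))
                           (Σ-single n j f (ℕP.≤-pred (ℕP.≤∧≢⇒< j≤ j≢)) (λ k k≤n → eq k (ℕP.m≤n⇒m≤1+n k≤n)))

  Σ-rev : ∀ n f → Σ n f ≈ Σ n (λ k → f (n ∸ k))
  Σ-rev zero    f = refl
  Σ-rev (suc n) f = begin
    Σ n f + f (suc n)                 ≈⟨ +-comm _ _ ⟩
    f (suc n) + Σ n f                 ≈⟨ +-congˡ (Σ-rev n f) ⟩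
    f (suc n) + Σ n (λ k → f (n ∸ k)) ≈⟨ Σ-first n (λ k → f (suc n ∸ k)) ⟨
    Σ (suc n) (λ k → f (suc n ∸ k))   ∎

  ιR : ℕ → Carrier
  ιR n = n × 1#

  ιR-+ : ∀ m n → ιR (m ℕ.+ n) ≈ ιR m + ιR n
  ιR-+ m n = ×-homo-+ 1# m n

  ιR-* : ∀ m n → ιR (m ℕ.* n) ≈ ιR m * ιR n
  ιR-* = ×1-homo-*

  ιR-cong : ∀ {m n} → m ≡ n → ιR m ≈ ιR n
  ιR-cong P.refl = refl

  ιR-pascal : ∀ n k → ιR (n C k) + ιR (n C suc k) ≈ ιR (suc n C suc k)
  ιR-pascal n k = trans (sym (ιR-+ (n C k) (n C suc k))) (ιR-cong (nCk+nC[k+1]≡[n+1]C[k+1] n k))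

  hockey-stick : ∀ N i → Σ N (λ p → ιR (p C i)) ≈ ιR (suc N C suc i)
  hockey-stick zero    zero    = refl
  hockey-stick zero    (suc i) = refl
  hockey-stick (suc N) i = trans (+-congʳ (hockey-stick N i)) (trans (+-comm _ _) (ιR-pascal (suc N) i))

  weighted-hockey-stick : ∀ N i → Σ N (λ p → ιR (suc (N ∸ p)) * ιR (p C i)) ≈ ιR (suc (suc N) C suc (suc i))
  weighted-hockey-stick zero    zero    = trans (*-congʳ (+-identityʳ 1#)) (*-identityˡ (ιR 1))
  weighted-hockey-stick zero    (suc i) = zeroʳ (ιR 1)
  weighted-hockey-stick (suc N) i = begin
    Σ N (λ p → ιR (suc (suc N ∸ p)) * ιR (p C i)) + ιR (suc (suc N ∸ suc N)) * ιR (suc N C i)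
      ≈⟨ +-cong (Σ-cong N (λ p p≤N → reflexive (P.cong (λ z → ιR (suc z) * ιR (p C i)) (ℕP.+-∸-assoc 1 p≤N))))
                (reflexive (P.cong (λ z → ιR (suc z) * ιR (suc N C i)) (ℕP.n∸n≡0 N))) ⟩
    Σ N (λ p → (1# + ιR (suc (N ∸ p))) * ιR (p C i)) + ιR 1 * ιR (suc N C i)
      ≈⟨ +-cong (trans (Σ-cong′ N (λ p → trans (distribʳ _ _ _) (+-congʳ (*-identityˡ _)))) (Σ-+ N _ _))
                (trans (*-congʳ (+-identityʳ 1#)) (*-identityˡ _)) ⟩
    (Σ N (λ p → ιR (p C i)) + Σ N (λ p → ιR (suc (N ∸ p)) * ιR (p C i))) + ιR (suc N C i)
      ≈⟨ +-congʳ (+-cong (hockey-stick N i) (weighted-hockey-stick N i)) ⟩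
    (ιR (suc N C suc i) + ιR (suc (suc N) C suc (suc i))) + ιR (suc N C i)
      ≈⟨ xy∙z≈zx∙y _ _ _ ⟩
    (ιR (suc N C i) + ιR (suc N C suc i)) + ιR (suc (suc N) C suc (suc i))
      ≈⟨ +-congʳ (ιR-pascal (suc N) i) ⟩
    ιR (suc (suc N) C suc i) + ιR (suc (suc N) C suc (suc i))
      ≈⟨ ιR-pascal (suc (suc N)) (suc i) ⟩
    ιR (suc (suc (suc N)) C suc (suc i)) ∎

-- Exponential generating functions over R: a sequence f stands for Σ f n xⁿ/n!.
-- The product is binomial convolution, defined here through the Leibniz rule
-- ∂(f·g) = ∂f·g + f·∂g for the derivative ∂ (the shift); its closed binomial form
-- is proved afterwards.
module EGF {c ℓ} (R : CommutativeRing c ℓ) where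

  open CommutativeRing R hiding (zero)
  open import Relation.Binary.Reasoning.Setoid setoid
  open import Algebra.Properties.Ring ring using (-‿+-comm; -‿distribʳ-*)
  open FiniteSums R public

  Seq : Set c
  Seq = ℕ → Carrier

  infix 4 _≋_
  _≋_ : Seq → Seq → Set ℓ
  f ≋ g = ∀ n → f n ≈ g n

  ∂ : Seq → Seq
  ∂ f n = f (suc n)

  conv : ℕ → Seq → Seq → Carrier
  conv zero    f g = f 0 * g 0
  conv (suc n) f g = conv n (∂ f) g + conv n f (∂ g)

  infixl 7 _⊛_
  infixl 6 _⊕_
  _⊛_ : Seq → Seq → Seq
  (f ⊛ g) n = conv n f g

  _⊕_ : Seq → Seq → Seq
  (f ⊕ g) n = f n + g n

  ⊖ : Seq → Seq
  ⊖ f n = - f n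

  𝟘 : Seq
  𝟘 _ = 0#

  const : Carrier → Seq
  const a zero    = a
  const a (suc n) = 0#

  𝟙 : Seq
  𝟙 = const 1#

  𝕩 : Seq
  𝕩 zero          = 0#
  𝕩 (suc zero)    = 1#
  𝕩 (suc (suc n)) = 0#

  exp : Seq
  exp _ = 1#

  expm1 : Seq
  expm1 zero    = 0#
  expm1 (suc n) = 1#

  conv-cong : ∀ n {f f′ g g′} → f ≋ f′ → g ≋ g′ → conv n f g ≈ conv n f′ g′
  conv-cong zero    ff gg = *-cong (ff 0) (gg 0)
  conv-cong (suc n) ff gg = +-cong (conv-cong n (λ k → ff (suc k)) gg) (conv-cong n ff (λ k → gg (suc k)))

  conv-comm : ∀ n f g → conv n f g ≈ conv n g f
  conv-comm zero    f g = *-comm _ _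
  conv-comm (suc n) f g = trans (+-cong (conv-comm n (∂ f) g) (conv-comm n f (∂ g))) (+-comm _ _)

  conv-distribˡ : ∀ n f g h → conv n f (g ⊕ h) ≈ conv n f g + conv n f h
  conv-distribˡ zero    f g h = distribˡ _ _ _
  conv-distribˡ (suc n) f g h =
    trans (+-cong (conv-distribˡ n (∂ f) g h) (conv-distribˡ n f (∂ g) (∂ h))) (interchange _ _ _ _)
    where open import Algebra.Properties.CommutativeSemigroup +-commutativeSemigroup using (interchange)

  conv-distribʳ : ∀ n f g h → conv n (g ⊕ h) f ≈ conv n g f + conv n h f
  conv-distribʳ n f g h =
    trans (conv-comm n _ _) (trans (conv-distribˡ n f g h) (+-cong (conv-comm n f g) (conv-comm n f h)))

  conv-zeroˡ : ∀ n f → conv n 𝟘 f ≈ 0#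
  conv-zeroˡ zero    f = zeroˡ _
  conv-zeroˡ (suc n) f = trans (+-cong (conv-zeroˡ n f) (conv-zeroˡ n (∂ f))) (+-identityˡ 0#)

  conv-const : ∀ n a f → conv n (const a) f ≈ a * f n
  conv-const zero    a f = refl
  conv-const (suc n) a f = trans (+-cong (conv-zeroˡ n f) (conv-const n a (∂ f))) (+-identityˡ _)

  conv-identityˡ : ∀ n f → conv n 𝟙 f ≈ f n
  conv-identityˡ n f = trans (conv-const n 1# f) (*-identityˡ _)

  conv-negʳ : ∀ n f g → conv n f (⊖ g) ≈ - conv n f g
  conv-negʳ zero    f g = sym (-‿distribʳ-* _ _)
  conv-negʳ (suc n) f g = trans (+-cong (conv-negʳ n (∂ f) g) (conv-negʳ n f (∂ g))) (-‿+-comm _ _)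

  conv-negˡ : ∀ n f g → conv n (⊖ f) g ≈ - conv n f g
  conv-negˡ n f g = trans (conv-comm n _ _) (trans (conv-negʳ n g f) (-‿cong (conv-comm n g f)))

  conv-assoc : ∀ n f g h → conv n (f ⊛ g) h ≈ conv n f (g ⊛ h)
  conv-assoc zero    f g h = *-assoc _ _ _
  conv-assoc (suc n) f g h = begin
    conv n ((∂ f ⊛ g) ⊕ (f ⊛ ∂ g)) h + conv n (f ⊛ g) (∂ h)
      ≈⟨ +-congʳ (conv-distribʳ n h (∂ f ⊛ g) (f ⊛ ∂ g)) ⟩
    (conv n (∂ f ⊛ g) h + conv n (f ⊛ ∂ g) h) + conv n (f ⊛ g) (∂ h)
      ≈⟨ +-cong (+-cong (conv-assoc n (∂ f) g h) (conv-assoc n f (∂ g) h)) (conv-assoc n f g (∂ h)) ⟩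
    (conv n (∂ f) (g ⊛ h) + conv n f (∂ g ⊛ h)) + conv n f (g ⊛ ∂ h)
      ≈⟨ +-assoc _ _ _ ⟩
    conv n (∂ f) (g ⊛ h) + (conv n f (∂ g ⊛ h) + conv n f (g ⊛ ∂ h))
      ≈⟨ +-congˡ (conv-distribˡ n f (∂ g ⊛ h) (g ⊛ ∂ h)) ⟨
    conv n (∂ f) (g ⊛ h) + conv n f ((∂ g ⊛ h) ⊕ (g ⊛ ∂ h)) ∎

  ∂𝕩≋𝟙 : ∂ 𝕩 ≋ 𝟙
  ∂𝕩≋𝟙 zero    = refl
  ∂𝕩≋𝟙 (suc n) = refl

  conv-𝕩 : ∀ n f → conv (suc n) 𝕩 f ≈ ιR (suc n) * f n
  conv-𝕩 zero f = begin
    conv 0 (∂ 𝕩) f + 𝕩 0 * f 1 ≈⟨ +-cong (conv-cong 0 {g = f} ∂𝕩≋𝟙 (λ _ → refl)) (zeroˡ _) ⟩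
    1# * f 0 + 0#              ≈⟨ +-identityʳ _ ⟩
    1# * f 0                   ≈⟨ *-congʳ (+-identityʳ _) ⟨
    (1# + 0#) * f 0            ∎
  conv-𝕩 (suc n) f = begin
    conv (suc n) (∂ 𝕩) f + conv (suc n) 𝕩 (∂ f) ≈⟨ +-cong (conv-cong (suc n) {g = f} ∂𝕩≋𝟙 (λ _ → refl)) (conv-𝕩 n (∂ f)) ⟩
    conv (suc n) 𝟙 f + ιR (suc n) * f (suc n)   ≈⟨ +-congʳ (conv-identityˡ (suc n) f) ⟩
    f (suc n) + ιR (suc n) * f (suc n)          ≈⟨ +-congʳ (*-identityˡ _) ⟨
    1# * f (suc n) + ιR (suc n) * f (suc n)     ≈⟨ distribʳ _ _ _ ⟨
    ιR (suc (suc n)) * f (suc n)                ∎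

  binom : ℕ → Seq → Seq → Carrier
  binom n f g = Σ n (λ k → ιR (n C k) * (f k * g (n ∸ k)))

  binom-suc : ∀ n f g → binom (suc n) f g ≈ binom n (∂ f) g + binom n f (∂ g)
  binom-suc n f g = begin
    binom (suc n) f g
      ≈⟨ Σ-first n _ ⟩
    ιR 1 * (f 0 * g (suc n)) + Σ n (λ k → ιR (suc n C suc k) * (f (suc k) * g (n ∸ k)))
      ≈⟨ +-congˡ (Σ-cong′ n (λ k → trans (*-congʳ (sym (ιR-pascal n k))) (distribʳ _ _ _))) ⟩
    ιR 1 * (f 0 * g (suc n)) + Σ n (λ k → ιR (n C k) * (f (suc k) * g (n ∸ k)) + ιR (n C suc k) * (f (suc k) * g (n ∸ k)))
      ≈⟨ +-congˡ (Σ-+ n _ _) ⟩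
    ιR 1 * (f 0 * g (suc n)) + (binom n (∂ f) g + shifted n)
      ≈⟨ x∙yz≈y∙xz _ _ _ ⟩
    binom n (∂ f) g + (ιR 1 * (f 0 * g (suc n)) + shifted n)
      ≈⟨ +-congˡ (binom-∂ʳ n) ⟨
    binom n (∂ f) g + binom n f (∂ g) ∎
    where
    open import Algebra.Properties.CommutativeSemigroup +-commutativeSemigroup using (x∙yz≈y∙xz)
    shifted : ℕ → Carrier
    shifted n = Σ n (λ k → ιR (n C suc k) * (f (suc k) * g (n ∸ k)))
    binom-∂ʳ : ∀ n → binom n f (∂ g) ≈ ιR 1 * (f 0 * g (suc n)) + shifted n
    binom-∂ʳ zero = sym (trans (+-congˡ (zeroˡ _)) (+-identityʳ _))
    binom-∂ʳ (suc n) = begin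
      binom (suc n) f (∂ g)
        ≈⟨ Σ-first n _ ⟩
      ιR 1 * (f 0 * g (suc (suc n))) + Σ n (λ k → ιR (suc n C suc k) * (f (suc k) * g (suc (n ∸ k))))
        ≈⟨ +-congˡ (Σ-cong n (λ k k≤n → *-congˡ (*-congˡ (reflexive (P.cong g (P.sym (ℕP.+-∸-assoc 1 k≤n))))))) ⟩
      ιR 1 * (f 0 * g (suc (suc n))) + Σ n (λ k → ιR (suc n C suc k) * (f (suc k) * g (suc n ∸ k)))
        ≈⟨ +-congˡ (Σ-last0 n _ (trans (*-congʳ (ιR-cong (k>n⇒nCk≡0 (ℕP.n<1+n (suc n))))) (zeroˡ _))) ⟨
      ιR 1 * (f 0 * g (suc (suc n))) + shifted (suc n) ∎

  conv-binom : ∀ n f g → conv n f g ≈ binom n f g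
  conv-binom zero    f g = sym (trans (*-congʳ (+-identityʳ _)) (*-identityˡ _))
  conv-binom (suc n) f g = trans (+-cong (conv-binom n (∂ f) g) (conv-binom n f (∂ g))) (sym (binom-suc n f g))

  egfRing : CommutativeRing c ℓ
  egfRing = record
    { Carrier = Seq
    ; _≈_ = _≋_
    ; _+_ = _⊕_
    ; _*_ = _⊛_
    ; -_ = ⊖
    ; 0# = 𝟘
    ; 1# = 𝟙
    ; isCommutativeRing = record
      { isRing = record
        { +-isAbelianGroup = record
          { isGroup = record
            { isMonoid = record
              { isSemigroup = record
                { isMagma = record
                  { isEquivalence = record
                    { refl = λ n → refl ; sym = λ e n → sym (e n) ; trans = λ e e′ n → trans (e n) (e′ n) }
                  ; ∙-cong = λ e e′ n → +-cong (e n) (e′ n) }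
                ; assoc = λ f g h n → +-assoc _ _ _ }
              ; identity = (λ f n → +-identityˡ _) , (λ f n → +-identityʳ _) }
            ; inverse = (λ f n → -‿inverseˡ _) , (λ f n → -‿inverseʳ _)
            ; ⁻¹-cong = λ e n → -‿cong (e n) }
          ; comm = λ f g n → +-comm _ _ }
        ; *-cong = λ e e′ n → conv-cong n e e′
        ; *-assoc = λ f g h n → conv-assoc n f g h
        ; *-identity = (λ f n → conv-identityˡ n f) , (λ f n → trans (conv-comm n f 𝟙) (conv-identityˡ n f))
        ; distrib = (λ f g h n → conv-distribˡ n f g h) , (λ f g h n → conv-distribʳ n f g h) }
      ; *-comm = λ f g n → conv-comm n f g } }

  -- If positive integers are non-zero-divisors, then eˣ - 1 is cancellable:
  -- the coefficient of xⁿ⁺¹ in (eˣ - 1)·h is (n+1) hₙ plus terms in h₀ … hₙ₋₁.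
  module Cancel (ιR-cancel : ∀ n x → ιR (suc n) * x ≈ 0# → x ≈ 0#) where

    expm1-annihilates : ∀ h → (∀ n → conv n expm1 h ≈ 0#) → h ≋ 𝟘
    expm1-annihilates h eq = strong (λ n ih → ιR-cancel n (h n) (begin
        ιR (suc n) * h n                               ≈⟨ *-cong (ιR-cong (nC1≡n (suc n))) (*-identityˡ _) ⟨
        ιR (suc n C 1) * (expm1 1 * h (suc n ∸ 1))     ≈⟨ Σ-single (suc n) 1 _ (s≤s z≤n) (others n ih) ⟨
        binom (suc n) expm1 h                          ≈⟨ conv-binom (suc n) expm1 h ⟨
        conv (suc n) expm1 h                           ≈⟨ eq (suc n) ⟩
        0#                                             ∎))
      where
      open import Data.Nat.Induction using (<-rec)
      strong : (∀ n → (∀ j → j < n → h j ≈ 0#) → h n ≈ 0#) → ∀ n → h n ≈ 0#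
      strong step = <-rec _ (λ n ih → step n (λ j j<n → ih j<n))
      others : ∀ n → (∀ j → j < n → h j ≈ 0#) →
               ∀ k → k ≤ suc n → k ≢ 1 → ιR (suc n C k) * (expm1 k * h (suc n ∸ k)) ≈ 0#
      others n ih zero          _        _  = trans (*-congˡ (zeroˡ _)) (zeroʳ _)
      others n ih (suc zero)    _        ne = Data.Empty.⊥-elim (ne P.refl)
        where import Data.Empty
      others n ih (suc (suc k)) (s≤s k≤) _  =
        trans (*-congˡ (*-congˡ (ih (n ∸ suc k) (ℕP.∸-monoʳ-< (s≤s z≤n) k≤)))) (trans (*-congˡ (zeroʳ _)) (zeroʳ _))

    expm1-cancel : ∀ f g → (∀ n → conv n expm1 f ≈ conv n expm1 g) → f ≋ g
    expm1-cancel f g eq n = difference-zero (expm1-annihilates (f ⊕ ⊖ g) (λ k → begin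
        conv k expm1 (f ⊕ ⊖ g)              ≈⟨ conv-distribˡ k expm1 f (⊖ g) ⟩
        conv k expm1 f + conv k expm1 (⊖ g) ≈⟨ +-cong (eq k) (conv-negʳ k expm1 g) ⟩
        conv k expm1 g - conv k expm1 g     ≈⟨ -‿inverseʳ _ ⟩
        0#                                  ∎) n)
      where
      difference-zero : ∀ {x y} → x - y ≈ 0# → x ≈ y
      difference-zero {x} {y} e = begin
        x             ≈⟨ +-identityʳ x ⟨
        x + 0#        ≈⟨ +-congˡ (-‿inverseˡ y) ⟨
        x + (- y + y) ≈⟨ +-assoc _ _ _ ⟨
        (x - y) + y   ≈⟨ +-congʳ e ⟩
        0# + y        ≈⟨ +-identityˡ y ⟩
        y             ∎

-- Two polynomial identities in an arbitrary commutative ring, isolated so that the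
-- generating-function arguments below can apply them inside rings of series.
module RingIdentities {a b} (A : CommutativeRing a b) where

  open CommutativeRing A
  open import Relation.Binary.Reasoning.Setoid setoid
  open import Algebra.Properties.Ring ring using (-‿+-comm; -‿involutive; -‿distribˡ-*)

  -- Read with e = eˣ, e′ = eˣ - 1, s = e⁻ˣ, s′ = e⁻ˣ - 1, t = x, b = B(x) and X = B(-x):
  -- from (eˣ - 1) B(x) = x one gets (eˣ - 1)(B(-x) - x) = (eˣ - 1) B(x).
  reflection-identity : ∀ e e′ s s′ X t b → e ≈ e′ + 1# → s′ ≈ s - 1# → e * s ≈ 1# →
                        s′ * X ≈ - t → e′ * b ≈ t → e′ * (X - t) ≈ e′ * b
  reflection-identity e e′ s s′ X t b e≈ s′≈ es≈1 s′X≈-t e′b≈t = begin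
    e′ * Y                 ≈⟨ trans (+-assoc _ _ _) (trans (+-congˡ (-‿inverseʳ Y)) (+-identityʳ _)) ⟨
    (e′ * Y + Y) - Y       ≈⟨ +-congʳ e′Y+Y≈X ⟩
    X - Y                  ≈⟨ +-congˡ (trans (sym (-‿+-comm X (- t))) (+-congˡ (-‿involutive t))) ⟩
    X + (- X + t)          ≈⟨ +-assoc _ _ _ ⟨
    (X - X) + t            ≈⟨ trans (+-congʳ (-‿inverseʳ X)) (+-identityˡ t) ⟩
    t                      ≈⟨ e′b≈t ⟨
    e′ * b                 ∎
    where
    Y = X - t
    Y≈sX : Y ≈ s * X
    Y≈sX = begin
      X - t                    ≈⟨ +-congˡ (trans (sym s′X≈-t) (*-congʳ s′≈)) ⟩
      X + (s - 1#) * X         ≈⟨ +-congˡ (distribʳ X s (- 1#)) ⟩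
      X + (s * X + - 1# * X)   ≈⟨ +-congˡ (+-congˡ (trans (sym (-‿distribˡ-* 1# X)) (-‿cong (*-identityˡ X)))) ⟩
      X + (s * X - X)          ≈⟨ +-congˡ (+-comm _ _) ⟩
      X + (- X + s * X)        ≈⟨ +-assoc _ _ _ ⟨
      (X - X) + s * X          ≈⟨ trans (+-congʳ (-‿inverseʳ X)) (+-identityˡ _) ⟩
      s * X                    ∎
    e′Y+Y≈X : e′ * Y + Y ≈ X
    e′Y+Y≈X = begin
      e′ * Y + Y             ≈⟨ +-congˡ (*-identityˡ Y) ⟨
      e′ * Y + 1# * Y        ≈⟨ distribʳ Y e′ 1# ⟨
      (e′ + 1#) * Y          ≈⟨ *-cong (sym e≈) Y≈sX ⟩
      e * (s * X)            ≈⟨ *-assoc _ _ _ ⟨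
      (e * s) * X            ≈⟨ trans (*-congʳ es≈1) (*-identityˡ X) ⟩
      X                      ∎

  -- Read with a = eᵘ - 1, g = eᵛ - 1, bu = B(u), bv = B(v), bd = B(u+v): since
  -- eᵘ⁺ᵛ - 1 = ag + a + g, the three defining relations of these Bernoulli series give
  -- (u+v) B(u) B(v) = uv B(u+v) + v B(u+v) B(u) + u B(u+v) B(v) after multiplying by ag.
  two-variable-identity : ∀ a g u v bu bv bd → a * bu ≈ u → g * bv ≈ v → (a * g + a + g) * bd ≈ u + v →
                          (a * g) * ((u + v) * bu * bv) ≈ (a * g) * (u * v * bd + v * bd * bu + u * bd * bv)
  two-variable-identity a g u v bu bv bd abu≈u gbv≈v abd≈u+v = begin
    (a * g) * ((u + v) * bu * bv)
      ≈⟨ solve 7 (λ a g u v bu bv bd → (a :* g) :* ((u :+ v) :* bu :* bv)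
                                     := (u :+ v) :* ((a :* bu) :* (g :* bv))) refl a g u v bu bv bd ⟩
    (u + v) * ((a * bu) * (g * bv))
      ≈⟨ trans (*-congˡ (*-cong abu≈u gbv≈v)) (*-comm _ _) ⟩
    (u * v) * (u + v)
      ≈⟨ *-congˡ (sym abd≈u+v) ⟩
    (u * v) * ((a * g + a + g) * bd)
      ≈⟨ solve 7 (λ a g u v bu bv bd → (u :* v) :* ((a :* g :+ a :+ g) :* bd)
                                     := (u :* v) :* (a :* g) :* bd :+ (v :* bd :* g :* u :+ u :* bd :* a :* v)) refl a g u v bu bv bd ⟩
    (u * v) * (a * g) * bd + (v * bd * g * u + u * bd * a * v)
      ≈⟨ +-congˡ (+-cong (*-congˡ (sym abu≈u)) (*-congˡ (sym gbv≈v))) ⟩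
    (u * v) * (a * g) * bd + (v * bd * g * (a * bu) + u * bd * a * (g * bv))
      ≈⟨ solve 7 (λ a g u v bu bv bd → (u :* v) :* (a :* g) :* bd :+ (v :* bd :* g :* (a :* bu) :+ u :* bd :* a :* (g :* bv))
                                     := (a :* g) :* (u :* v :* bd :+ v :* bd :* bu :+ u :* bd :* bv)) refl a g u v bu bv bd ⟩
    (a * g) * (u * v * bd + v * bd * bu + u * bd * bv)
      ∎
    where
    import Algebra.Solver.Ring.NaturalCoefficients.Default as NatSolver
    open NatSolver commutativeSemiring using (solve; _:+_; _:*_; _:=_)

module Rationals where

  open import Data.Integer as ℤ using (+_)
  import Data.Integer.Properties as ℤP
  open import Data.Rational using (_+_; _*_; _/_; 1ℚ; toℚᵘ)
  open import Data.Rational.Properties using (toℚᵘ-injective; toℚᵘ-fromℚᵘ; toℚᵘ-homo-+; toℚᵘ-homo-*)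
  import Data.Rational.Unnormalised as U
  import Data.Rational.Unnormalised.Properties as UP
  open P using (trans; sym; cong)

  inv : ℕ → ℚ
  inv d = + 1 / suc d

  ι-suc : ∀ n → ι (suc n) ≡ 1ℚ + ι n
  ι-suc n = toℚᵘ-injective (UP.≃-trans (toℚᵘ-fromℚᵘ (U.mkℚᵘ (+ suc n) 0)) (UP.≃-sym (begin
    toℚᵘ (1ℚ + ι n)                          ≈⟨ toℚᵘ-homo-+ 1ℚ (ι n) ⟩
    toℚᵘ 1ℚ U.+ toℚᵘ (ι n)                   ≈⟨ UP.+-cong (toℚᵘ-fromℚᵘ (U.mkℚᵘ (+ 1) 0)) (toℚᵘ-fromℚᵘ (U.mkℚᵘ (+ n) 0)) ⟩
    U.mkℚᵘ (+ 1) 0 U.+ U.mkℚᵘ (+ n) 0        ≈⟨ U.*≡* cross ⟩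
    U.mkℚᵘ (+ suc n) 0                       ∎)))
    where
    open UP.≃-Reasoning
    cross : (+ 1 ℤ.* + 1 ℤ.+ + n ℤ.* + 1) ℤ.* + 1 ≡ + suc n ℤ.* (+ 1 ℤ.* + 1)
    cross = trans (ℤP.*-identityʳ _) (trans (cong (λ z → + 1 ℤ.+ z) (ℤP.*-identityʳ (+ n))) (sym (ℤP.*-identityʳ _)))

  ι-inv : ∀ d → ι (suc d) * inv d ≡ 1ℚ
  ι-inv d = toℚᵘ-injective (begin
    toℚᵘ (ι (suc d) * inv d)                  ≈⟨ toℚᵘ-homo-* (ι (suc d)) (inv d) ⟩
    toℚᵘ (ι (suc d)) U.* toℚᵘ (inv d)         ≈⟨ UP.*-cong (toℚᵘ-fromℚᵘ (U.mkℚᵘ (+ suc d) 0)) (toℚᵘ-fromℚᵘ (U.mkℚᵘ (+ 1) d)) ⟩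
    U.mkℚᵘ (+ suc d) 0 U.* U.mkℚᵘ (+ 1) d     ≈⟨ U.*≡* (cong (λ x → + suc x) cross) ⟩
    U.mkℚᵘ (+ 1) 0                            ≈⟨ toℚᵘ-fromℚᵘ (U.mkℚᵘ (+ 1) 0) ⟨
    toℚᵘ 1ℚ                                   ∎)
    where
    open UP.≃-Reasoning
    cross : d ℕ.* 1 ℕ.* 1 ≡ d ℕ.+ 0 ℕ.+ 0
    cross = trans (trans (ℕP.*-identityʳ (d ℕ.* 1)) (ℕP.*-identityʳ d))
                  (sym (trans (ℕP.+-identityʳ (d ℕ.+ 0)) (ℕP.+-identityʳ d)))

  /-ι : ∀ a d → (+ a) / suc d ≡ ι a * inv d
  /-ι a d = toℚᵘ-injective (UP.≃-sym (begin
    toℚᵘ (ι a * inv d)                        ≈⟨ toℚᵘ-homo-* (ι a) (inv d) ⟩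
    toℚᵘ (ι a) U.* toℚᵘ (inv d)               ≈⟨ UP.*-cong (toℚᵘ-fromℚᵘ (U.mkℚᵘ (+ a) 0)) (toℚᵘ-fromℚᵘ (U.mkℚᵘ (+ 1) d)) ⟩
    U.mkℚᵘ (+ a) 0 U.* U.mkℚᵘ (+ 1) d         ≈⟨ U.*≡* cross ⟩
    U.mkℚᵘ (+ a) d                            ≈⟨ toℚᵘ-fromℚᵘ (U.mkℚᵘ (+ a) d) ⟨
    toℚᵘ ((+ a) / suc d)                      ∎))
    where
    open UP.≃-Reasoning
    cross : (+ a ℤ.* + 1) ℤ.* + suc d ≡ + a ℤ.* + suc (d ℕ.+ 0)
    cross = trans (cong (ℤ._* + suc d) (ℤP.*-identityʳ (+ a))) (cong (λ x → + a ℤ.* + suc x) (sym (ℕP.+-identityʳ d)))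

module Bernoulli where

  open import Data.Rational.Properties using (+-*-commutativeRing)
  open import Data.Bool using (false)
  open import Data.Bool.Properties using (T-≡)
  open import Function.Bundles using (Equivalence)
  open Rationals using (inv; ι-suc; ι-inv)

  ℚ-ring : CommutativeRing _ _
  ℚ-ring = +-*-commutativeRing

  open EGF ℚ-ring public
  open CommutativeRing ℚ-ring hiding (zero)
  open import Algebra.Properties.Ring ring using (-‿distribʳ-*; -‿distribˡ-*; -‿+-comm; -‿involutive)
  open P using (cong; cong₂)
  open P.≡-Reasoning

  Σ≡sumTo : ∀ n f → Σ n f ≡ sumTo n f
  Σ≡sumTo zero    f = P.refl
  Σ≡sumTo (suc n) f = cong (_+ f (suc n)) (Σ≡sumTo n f)

  ι≡ιR : ∀ n → ι n ≡ ιR n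
  ι≡ιR zero    = P.refl
  ι≡ιR (suc n) = P.trans (ι-suc n) (cong (1# +_) (ι≡ιR n))

  ιR-inv : ∀ d → ιR (suc d) * inv d ≡ 1#
  ιR-inv d = P.trans (cong (_* inv d) (P.sym (ι≡ιR (suc d)))) (ι-inv d)

  -- Positive integers are invertible in ℚ, so eˣ - 1 is cancellable.
  ιR-cancel : ∀ n x → ιR (suc n) * x ≡ 0# → x ≡ 0#
  ιR-cancel n x eq = begin
    x                        ≡⟨ *-identityˡ x ⟨
    1# * x                   ≡⟨ cong (_* x) (P.trans (*-comm (inv n) (ιR (suc n))) (ιR-inv n)) ⟨
    (inv n * ιR (suc n)) * x ≡⟨ *-assoc (inv n) (ιR (suc n)) x ⟩
    inv n * (ιR (suc n) * x) ≡⟨ cong (inv n *_) eq ⟩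
    inv n * 0#               ≡⟨ zeroʳ (inv n) ⟩
    0#                       ∎

  open Cancel ιR-cancel public

  bernTable-stable : ∀ n k → k ≤ n → bernTable n k ≡ B k
  bernTable-stable zero    zero z≤n = P.refl
  bernTable-stable (suc n) k    k≤  with k ℕ.≟ suc n
  ... | yes P.refl = P.refl
  ... | no  k≢     with ℕP.≤-pred (ℕP.≤∧≢⇒< k≤ k≢)
  ...   | k≤n rewrite Equivalence.to T-≡ (ℕP.≤⇒≤ᵇ k≤n) = bernTable-stable n k k≤n

  -- n + 1 ≤ᵇ n computes to n <ᵇ n, which is false: row n + 1 adds the new entry Bₙ₊₁.
  <ᵇ-irrefl : ∀ n → (n ℕ.<ᵇ n) ≡ false
  <ᵇ-irrefl zero    = P.refl
  <ᵇ-irrefl (suc n) = <ᵇ-irrefl n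

  B-suc : ∀ n → B (suc n) ≡ - (inv (suc n) * Σ n (λ j → ιR (suc (suc n) C j) * B j))
  B-suc n rewrite <ᵇ-irrefl n =
    cong (λ z → - (inv (suc n) * z))
         (P.trans (P.sym (Σ≡sumTo n _))
                  (Σ-cong n (λ k k≤n → cong₂ _*_ (ι≡ιR (suc (suc n) C k)) (bernTable-stable n k k≤n))))

  B-recurrence : ∀ n → Σ (suc n) (λ j → ιR (suc (suc n) C j) * B j) ≡ 0#
  B-recurrence n = begin
    s + ιR (suc (suc n) C suc n) * B (suc n) ≡⟨ cong₂ (λ a b → s + a * b) (ιR-cong (C-last (suc n))) (B-suc n) ⟩
    s + c * - (i * s)                      ≡⟨ cong (s +_) (-‿distribʳ-* c (i * s)) ⟨
    s + - (c * (i * s))                    ≡⟨ cong (λ z → s + - z) (*-assoc c i s) ⟨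
    s + - ((c * i) * s)                    ≡⟨ cong (λ z → s + - (z * s)) (ιR-inv (suc n)) ⟩
    s + - (1# * s)                         ≡⟨ cong (λ z → s + - z) (*-identityˡ s) ⟩
    s - s                                  ≡⟨ -‿inverseʳ s ⟩
    0#                                     ∎
    where
    s = Σ n (λ j → ιR (suc (suc n) C j) * B j)
    c = ιR (suc (suc n))
    i = inv (suc n)
    C-last : ∀ n → suc n C n ≡ suc n
    C-last n = P.trans (nCk≡nC[n∸k] (ℕP.n≤1+n n))
                       (P.trans (cong (suc n C_) (P.trans (ℕP.+-∸-assoc 1 (ℕP.≤-refl {n})) (cong suc (ℕP.n∸n≡0 n))))
                                (nC1≡n (suc n)))

  expm1-B : ∀ n → conv n expm1 B ≡ 𝕩 n
  expm1-B n = P.trans (conv-comm n expm1 B) (P.trans (conv-binom n B expm1) (closed n))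
    where
    closed : ∀ n → binom n B expm1 ≡ 𝕩 n
    closed zero    = P.trans (cong (ιR 1 *_) (zeroʳ (B 0))) (zeroʳ (ιR 1))
    closed (suc n) = begin
      binom (suc n) B expm1
        ≡⟨ Σ-last0 n _ (P.trans (cong (λ z → ιR (suc n C suc n) * (B (suc n) * expm1 z)) (ℕP.n∸n≡0 n))
                                 (P.trans (cong (ιR (suc n C suc n) *_) (zeroʳ (B (suc n)))) (zeroʳ (ιR (suc n C suc n))))) ⟩
      Σ n (λ k → ιR (suc n C k) * (B k * expm1 (suc n ∸ k)))
        ≡⟨ Σ-cong n (λ k k≤n → cong (λ z → ιR (suc n C k) * (B k * expm1 z)) (ℕP.+-∸-assoc 1 k≤n)) ⟩
      Σ n (λ k → ιR (suc n C k) * (B k * 1#))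
        ≡⟨ Σ-cong′ n (λ k → cong (ιR (suc n C k) *_) (*-identityʳ (B k))) ⟩
      Σ n (λ k → ιR (suc n C k) * B k)
        ≡⟨ recurrence n ⟩
      𝕩 (suc n) ∎
      where
      recurrence : ∀ n → Σ n (λ k → ιR (suc n C k) * B k) ≡ 𝕩 (suc n)
      recurrence zero    = P.refl
      recurrence (suc n) = B-recurrence n

  -- The substitution x ↦ -x multiplies the n-th coefficient by (-1)ⁿ.
  sgn : ℕ → ℚ
  sgn zero    = 1#
  sgn (suc n) = - sgn n

  σ : Seq → Seq
  σ f n = sgn n * f n

  ∂σ : ∀ f → ∂ (σ f) ≋ ⊖ (σ (∂ f))
  ∂σ f n = P.sym (-‿distribˡ-* (sgn n) (f (suc n)))

  σ-conv : ∀ n f g → conv n (σ f) (σ g) ≡ sgn n * conv n f g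
  σ-conv zero    f g = P.trans (cong₂ _*_ (*-identityˡ (f 0)) (*-identityˡ (g 0))) (P.sym (*-identityˡ (f 0 * g 0)))
  σ-conv (suc n) f g = begin
    conv n (∂ (σ f)) (σ g) + conv n (σ f) (∂ (σ g))
      ≡⟨ cong₂ _+_ (conv-cong n (∂σ f) (λ _ → P.refl)) (conv-cong n (λ _ → P.refl) (∂σ g)) ⟩
    conv n (⊖ (σ (∂ f))) (σ g) + conv n (σ f) (⊖ (σ (∂ g)))
      ≡⟨ cong₂ _+_ (conv-negˡ n _ _) (conv-negʳ n _ _) ⟩
    - conv n (σ (∂ f)) (σ g) + - conv n (σ f) (σ (∂ g))
      ≡⟨ cong₂ (λ a b → - a + - b) (σ-conv n (∂ f) g) (σ-conv n f (∂ g)) ⟩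
    - (sgn n * conv n (∂ f) g) + - (sgn n * conv n f (∂ g))
      ≡⟨ -‿+-comm (sgn n * conv n (∂ f) g) (sgn n * conv n f (∂ g)) ⟩
    - (sgn n * conv n (∂ f) g + sgn n * conv n f (∂ g))
      ≡⟨ cong -_ (distribˡ (sgn n) _ _) ⟨
    - (sgn n * (conv n (∂ f) g + conv n f (∂ g)))
      ≡⟨ -‿distribˡ-* (sgn n) _ ⟩
    (- sgn n) * (conv n (∂ f) g + conv n f (∂ g)) ∎

  exp-σexp : ∀ n → conv n exp (σ exp) ≡ 𝟙 n
  exp-σexp zero    = P.refl
  exp-σexp (suc n) = begin
    conv n exp (σ exp) + conv n exp (∂ (σ exp))   ≡⟨ cong (conv n exp (σ exp) +_) (P.trans (conv-cong n (λ _ → P.refl) (∂σ exp)) (conv-negʳ n exp (σ exp))) ⟩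
    conv n exp (σ exp) - conv n exp (σ exp)       ≡⟨ -‿inverseʳ (conv n exp (σ exp)) ⟩
    0#                                            ∎

  -- B(-x) = B(x) + x: apply the reflection identity in the ring of series and cancel eˣ - 1.
  B-reflect : σ B ⊕ ⊖ 𝕩 ≋ B
  B-reflect = expm1-cancel (σ B ⊕ ⊖ 𝕩) B
    (reflection-identity exp expm1 (σ exp) (σ expm1) (σ B) 𝕩 B exp≋ σexpm1≋ exp-σexp σexpm1-σB expm1-B)
    where
    open RingIdentities egfRing using (reflection-identity)
    exp≋ : exp ≋ expm1 ⊕ 𝟙
    exp≋ zero    = P.sym (+-identityˡ 1#)
    exp≋ (suc n) = P.sym (+-identityʳ 1#)
    σexpm1≋ : σ expm1 ≋ σ exp ⊕ ⊖ 𝟙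
    σexpm1≋ zero    = P.refl
    σexpm1≋ (suc n) = P.sym (+-identityʳ (sgn (suc n) * 1#))
    σ𝕩 : σ 𝕩 ≋ ⊖ 𝕩
    σ𝕩 zero          = zeroʳ 1#
    σ𝕩 (suc zero)    = P.refl
    σ𝕩 (suc (suc n)) = zeroʳ (sgn (suc (suc n)))
    σexpm1-σB : σ expm1 ⊛ σ B ≋ ⊖ 𝕩
    σexpm1-σB n = P.trans (σ-conv n expm1 B) (P.trans (cong (sgn n *_) (expm1-B n)) (σ𝕩 n))

  -- Bₙ = 0 for odd n ≥ 3: the coefficient identity (-1)ⁿ Bₙ = Bₙ from B-reflect.
  B-odd : ∀ k → B (suc (suc (suc (k ℕ.+ k)))) ≡ 0#
  B-odd k = ιR-cancel 1 b (begin
    ιR 2 * b     ≡⟨ distribʳ b 1# (1# + 0#) ⟩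
    1# * b + (1# + 0#) * b ≡⟨ cong₂ _+_ (*-identityˡ b) (P.trans (cong (_* b) (+-identityʳ 1#)) (*-identityˡ b)) ⟩
    b + b        ≡⟨ cong (b +_) -b≡b ⟨
    b - b        ≡⟨ -‿inverseʳ b ⟩
    0#           ∎)
    where
    n = suc (suc (suc (k ℕ.+ k)))
    b = B n
    sgn-even : ∀ k → sgn (k ℕ.+ k) ≡ 1#
    sgn-even zero    = P.refl
    sgn-even (suc k) rewrite ℕP.+-suc k k = P.trans (-‿involutive _) (sgn-even k)
    -b≡b : - b ≡ b
    -b≡b = begin
      - b            ≡⟨ cong -_ (*-identityˡ b) ⟨
      - (1# * b)     ≡⟨ -‿distribˡ-* 1# b ⟩
      (- 1#) * b     ≡⟨ cong (λ z → (- z) * b) (P.trans (-‿involutive _) (sgn-even k)) ⟨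
      sgn n * b      ≡⟨ +-identityʳ _ ⟨
      sgn n * b - 0# ≡⟨ B-reflect n ⟩
      b              ∎

-- Exponential generating functions in two variables u, v, as series in u whose
-- coefficients are series in v: F p q is the coefficient of uᵖvᵠ/(p! q!).  With
-- a = eᵘ - 1 and g = eᵛ - 1 we have eᵘ⁺ᵛ - 1 = ag + a + g, which yields
-- (u+v) B(u) B(v) = uv B(u+v) + v B(u+v) B(u) + u B(u+v) B(v).
module TwoVariable where

  open Bernoulli
  open CommutativeRing ℚ-ring hiding (zero)
  open P using (cong; cong₂)
  open P.≡-Reasoning
  import Algebra.Solver.Ring.NaturalCoefficients.Default as NatSolver

  module E₂ = EGF egfRing
  open E₂ using () renaming (_≋_ to _≋₂_; _⊛_ to _⊛₂_; _⊕_ to _⊕₂_)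

  Seq₂ : Set
  Seq₂ = ℕ → Seq

  -- A series a in the variable u, in v, and a(u + v).
  inU : Seq → Seq₂
  inU a p = const (a p)

  inV : Seq → Seq₂
  inV = E₂.const

  onSum : Seq → Seq₂
  onSum a p q = a (p ℕ.+ q)

  const-conv : ∀ q x y → conv q (const x) (const y) ≡ const (x * y) q
  const-conv q x y = P.trans (conv-const q x (const y)) (scale q)
    where
    scale : ∀ q → x * const y q ≡ const (x * y) q
    scale zero    = P.refl
    scale (suc q) = zeroʳ x

  const-+ : ∀ x y q → const x q + const y q ≡ const (x + y) q
  const-+ x y zero    = P.refl
  const-+ x y (suc q) = +-identityʳ 0#

  inU-conv : ∀ p a b → E₂.conv p (inU a) (inU b) ≋ const (conv p a b)
  inU-conv zero    a b q = const-conv q (a 0) (b 0)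
  inU-conv (suc p) a b q = P.trans (cong₂ _+_ (inU-conv p (∂ a) b q) (inU-conv p a (∂ b) q)) (const-+ _ _ q)

  inV-conv : ∀ p a b → E₂.conv p (inV a) (inV b) ≋ inV (a ⊛ b) p
  inV-conv zero    a b q = E₂.conv-const zero a (inV b) q
  inV-conv (suc p) a b q = P.trans (E₂.conv-const (suc p) a (inV b) q)
                                   (P.trans (conv-comm q a 𝟘) (conv-zeroˡ q a))

  onSum-conv : ∀ p a b q → E₂.conv p (onSum a) (onSum b) q ≡ conv (p ℕ.+ q) a b
  onSum-conv zero    a b q = P.refl
  onSum-conv (suc p) a b q = cong₂ _+_ (onSum-conv p (∂ a) b q) (onSum-conv p a (∂ b) q)

  inU-inV : ∀ a c p q → (inU a ⊛₂ inV c) p q ≡ a p * c q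
  inU-inV a c p q = begin
    E₂.conv p (inU a) (inV c) q ≡⟨ E₂.conv-comm p (inU a) (inV c) q ⟩
    E₂.conv p (inV c) (inU a) q ≡⟨ E₂.conv-const p c (inU a) q ⟩
    conv q c (const (a p))      ≡⟨ conv-comm q c _ ⟩
    conv q (const (a p)) c      ≡⟨ conv-const q (a p) c ⟩
    a p * c q                   ∎

  inU-expm1 : inU expm1 ≋₂ E₂.expm1
  inU-expm1 zero    zero    = P.refl
  inU-expm1 zero    (suc q) = P.refl
  inU-expm1 (suc p) q       = P.refl

  inU-𝕩 : inU 𝕩 ≋₂ E₂.𝕩
  inU-𝕩 zero          zero    = P.refl
  inU-𝕩 zero          (suc q) = P.refl
  inU-𝕩 (suc zero)    q       = P.refl
  inU-𝕩 (suc (suc p)) zero    = P.refl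
  inU-𝕩 (suc (suc p)) (suc q) = P.refl

  conv-ιR₂ : ∀ m x q → conv q (E₂.ιR m) x ≡ ιR m * x q
  conv-ιR₂ zero    x q = P.trans (conv-zeroˡ q x) (P.sym (zeroˡ (x q)))
  conv-ιR₂ (suc m) x q = begin
    conv q (𝟙 ⊕ E₂.ιR m) x          ≡⟨ conv-distribʳ q x 𝟙 (E₂.ιR m) ⟩
    conv q 𝟙 x + conv q (E₂.ιR m) x ≡⟨ cong₂ _+_ (conv-identityˡ q x) (conv-ιR₂ m x q) ⟩
    x q + ιR m * x q                ≡⟨ cong (_+ ιR m * x q) (*-identityˡ (x q)) ⟨
    1# * x q + ιR m * x q           ≡⟨ distribʳ (x q) 1# (ιR m) ⟨
    (1# + ιR m) * x q               ∎

  -- So positive integers are cancellable in the inner ring as well, and eᵘ - 1 can be cancelled.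
  ιR₂-cancel : ∀ n x → E₂.ιR (suc n) ⊛ x ≋ 𝟘 → x ≋ 𝟘
  ιR₂-cancel n x h q = ιR-cancel n (x q) (P.trans (P.sym (conv-ιR₂ (suc n) x q)) (h q))

  open E₂.Cancel ιR₂-cancel using () renaming (expm1-cancel to expm1-cancel₂)

  a g u v Bu Bv Buv : Seq₂
  a   = inU expm1
  g   = inV expm1
  u   = inU 𝕩
  v   = inV 𝕩
  Bu  = inU B
  Bv  = inV B
  Buv = onSum B

  lhs rhs : Seq₂
  lhs = (u ⊕₂ v) ⊛₂ Bu ⊛₂ Bv
  rhs = u ⊛₂ v ⊛₂ Buv ⊕₂ v ⊛₂ Buv ⊛₂ Bu ⊕₂ u ⊛₂ Buv ⊛₂ Bv

  a-Bu : a ⊛₂ Bu ≋₂ u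
  a-Bu p q = P.trans (inU-conv p expm1 B q) (cong (λ z → const z q) (expm1-B p))

  g-Bv : g ⊛₂ Bv ≋₂ v
  g-Bv zero    q = P.trans (inV-conv zero expm1 B q) (expm1-B q)
  g-Bv (suc p) q = inV-conv (suc p) expm1 B q

  exp-sum : ∀ p q → (a ⊛₂ g ⊕₂ a ⊕₂ g) p q ≡ onSum expm1 p q
  exp-sum p q = P.trans (cong (λ z → z + const (expm1 p) q + g p q) (inU-inV expm1 expm1 p q)) (coeff p q)
    where
    coeff : ∀ p q → expm1 p * expm1 q + const (expm1 p) q + g p q ≡ onSum expm1 p q
    coeff zero    zero    = P.refl
    coeff zero    (suc q) = P.refl
    coeff (suc p) zero    = P.refl
    coeff (suc p) (suc q) = P.refl

  𝕩-sum : ∀ p q → onSum 𝕩 p q ≡ (u ⊕₂ v) p q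
  𝕩-sum zero          zero          = P.refl
  𝕩-sum zero          (suc zero)    = P.refl
  𝕩-sum zero          (suc (suc q)) = P.refl
  𝕩-sum (suc zero)    zero          = P.refl
  𝕩-sum (suc zero)    (suc q)       = P.refl
  𝕩-sum (suc (suc p)) zero          = P.refl
  𝕩-sum (suc (suc p)) (suc q)       = P.refl

  expm1-sum-Buv : (a ⊛₂ g ⊕₂ a ⊕₂ g) ⊛₂ Buv ≋₂ u ⊕₂ v
  expm1-sum-Buv p q = begin
    E₂.conv p (a ⊛₂ g ⊕₂ a ⊕₂ g) Buv q ≡⟨ E₂.conv-cong p {g = Buv} exp-sum (λ _ _ → P.refl) q ⟩
    E₂.conv p (onSum expm1) Buv q     ≡⟨ onSum-conv p expm1 B q ⟩
    conv (p ℕ.+ q) expm1 B            ≡⟨ expm1-B (p ℕ.+ q) ⟩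
    onSum 𝕩 p q                       ≡⟨ 𝕩-sum p q ⟩
    (u ⊕₂ v) p q                      ∎

  -- The two-variable identity: cancel a and g from the ring identity.
  product-identity : lhs ≋₂ rhs
  product-identity p = expm1-cancel (lhs p) (rhs p) (λ n →
    P.trans (P.sym (E₂.conv-const p expm1 lhs n)) (P.trans (g-cancelled p n) (E₂.conv-const p expm1 rhs n)))
    where
    open RingIdentities E₂.egfRing using (two-variable-identity)
    module R₂ = CommutativeRing E₂.egfRing
    open import Relation.Binary.Reasoning.Setoid R₂.setoid renaming (begin_ to begin₂_; _∎ to _∎₂)
    ag-cancelled : (a ⊛₂ g) ⊛₂ lhs ≋₂ (a ⊛₂ g) ⊛₂ rhs
    ag-cancelled = two-variable-identity a g u v Bu Bv Buv a-Bu g-Bv expm1-sum-Buv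
    g-cancelled : g ⊛₂ lhs ≋₂ g ⊛₂ rhs
    g-cancelled = expm1-cancel₂ (g ⊛₂ lhs) (g ⊛₂ rhs) (λ n → (begin₂
      E₂.expm1 ⊛₂ (g ⊛₂ lhs) ≈⟨ R₂.*-congʳ {g ⊛₂ lhs} inU-expm1 ⟨
      a ⊛₂ (g ⊛₂ lhs)        ≈⟨ R₂.*-assoc a g lhs ⟨
      (a ⊛₂ g) ⊛₂ lhs        ≈⟨ ag-cancelled ⟩
      (a ⊛₂ g) ⊛₂ rhs        ≈⟨ R₂.*-assoc a g rhs ⟩
      a ⊛₂ (g ⊛₂ rhs)        ≈⟨ R₂.*-congʳ {g ⊛₂ rhs} inU-expm1 ⟩
      E₂.expm1 ⊛₂ (g ⊛₂ rhs) ∎₂) n)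

  xB : Seq
  xB n = conv n 𝕩 B

  xB-suc : ∀ n → xB (suc n) ≡ ιR (suc n) * B n
  xB-suc n = conv-𝕩 n B

  lhs-coeff : ∀ p q → lhs p q ≡ xB p * B q + B p * xB q
  lhs-coeff p q = begin
    lhs p q
      ≡⟨ split p q ⟩
    E₂.conv p (u ⊛₂ Bu) Bv q + E₂.conv p Bu (v ⊛₂ Bv) q
      ≡⟨ cong₂ _+_ (E₂.conv-cong p {g = Bv} (λ p′ q′ → inU-conv p′ 𝕩 B q′) (λ _ _ → P.refl) q)
                   (E₂.conv-cong p {f = Bu} (λ _ _ → P.refl) (λ p′ q′ → inV-conv p′ 𝕩 B q′) q) ⟩
    E₂.conv p (inU xB) (inV B) q + E₂.conv p (inU B) (inV xB) q
      ≡⟨ cong₂ _+_ (inU-inV xB B p q) (inU-inV B xB p q) ⟩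
    xB p * B q + B p * xB q ∎
    where
    open NatSolver (CommutativeRing.commutativeSemiring E₂.egfRing) using (solve; _:+_; _:*_; _:=_)
    split : lhs ≋₂ (u ⊛₂ Bu) ⊛₂ Bv ⊕₂ Bu ⊛₂ (v ⊛₂ Bv)
    split = solve 4 (λ u v Bu Bv → (u :+ v) :* Bu :* Bv := (u :* Bu) :* Bv :+ Bu :* (v :* Bv)) (λ p q → P.refl) u v Bu Bv

  u-times-zero : ∀ Y q → (u ⊛₂ Y) 0 q ≡ 0#
  u-times-zero Y q = P.trans (conv-const q 0# (Y 0)) (zeroˡ (Y 0 q))

  u-times-suc : ∀ Y p q → (u ⊛₂ Y) (suc p) q ≡ ιR (suc p) * Y p q
  u-times-suc Y p q = begin
    E₂.conv (suc p) u Y q          ≡⟨ E₂.conv-cong (suc p) {g = Y} inU-𝕩 (λ _ _ → P.refl) q ⟩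
    E₂.conv (suc p) E₂.𝕩 Y q       ≡⟨ E₂.conv-𝕩 p Y q ⟩
    conv q (E₂.ιR (suc p)) (Y p)   ≡⟨ conv-ιR₂ (suc p) (Y p) q ⟩
    ιR (suc p) * Y p q             ∎

  v-times : ∀ Y p q → (v ⊛₂ Y) p q ≡ conv q 𝕩 (Y p)
  v-times Y p q = E₂.conv-const p 𝕩 Y q

  Bv-times : ∀ Y p q → (Bv ⊛₂ Y) p q ≡ conv q B (Y p)
  Bv-times Y p q = E₂.conv-const p B Y q

  X₁ X₂ X₃ : Seq₂
  X₁ = u ⊛₂ (v ⊛₂ Buv)
  X₂ = v ⊛₂ (Bu ⊛₂ Buv)
  X₃ = u ⊛₂ (Bv ⊛₂ Buv)

  rhs-split : ∀ p q → rhs p q ≡ X₁ p q + X₂ p q + X₃ p q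
  rhs-split = solve 5 (λ u v Bu Bv Buv → u :* v :* Buv :+ v :* Buv :* Bu :+ u :* Buv :* Bv
                                       := u :* (v :* Buv) :+ v :* (Bu :* Buv) :+ u :* (Bv :* Buv))
                      (λ p q → P.refl) u v Bu Bv Buv
    where open NatSolver (CommutativeRing.commutativeSemiring E₂.egfRing) using (solve; _:+_; _:*_; _:=_)

  X₁-zero : ∀ q → X₁ 0 q ≡ 0#
  X₁-zero q = u-times-zero (v ⊛₂ Buv) q

  X₁-suc-zero : ∀ p → X₁ (suc p) 0 ≡ 0#
  X₁-suc-zero p = P.trans (u-times-suc (v ⊛₂ Buv) p 0)
                          (P.trans (cong (ιR (suc p) *_) (P.trans (v-times Buv p 0) (zeroˡ (Buv p 0))))
                                   (zeroʳ (ιR (suc p))))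

  X₁-suc-suc : ∀ p q → X₁ (suc p) (suc q) ≡ ιR (suc p) * (ιR (suc q) * B (p ℕ.+ q))
  X₁-suc-suc p q = P.trans (u-times-suc (v ⊛₂ Buv) p (suc q))
                           (cong (ιR (suc p) *_) (P.trans (v-times Buv p (suc q)) (conv-𝕩 q (Buv p))))

  W : ℕ → ℕ → ℚ
  W p q = Σ p (λ i → ιR (p C i) * (B i * B ((p ∸ i) ℕ.+ q)))

  Bu-Buv : ∀ p q → (Bu ⊛₂ Buv) p q ≡ W p q
  Bu-Buv p q = begin
    E₂.conv p Bu Buv q                                       ≡⟨ E₂.conv-binom p Bu Buv q ⟩
    E₂.Σ p (λ i → E₂.ιR (p C i) ⊛ (Bu i ⊛ Buv (p ∸ i))) q    ≡⟨ Σ₂-eval p _ q ⟩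
    Σ p (λ i → conv q (E₂.ιR (p C i)) (Bu i ⊛ Buv (p ∸ i)))  ≡⟨ Σ-cong′ p (λ i → P.trans (conv-ιR₂ (p C i) _ q)
                                                                   (cong (ιR (p C i) *_) (conv-const q (B i) _))) ⟩
    W p q                                                    ∎
    where
    Σ₂-eval : ∀ n F q → E₂.Σ n F q ≡ Σ n (λ i → F i q)
    Σ₂-eval zero    F q = P.refl
    Σ₂-eval (suc n) F q = cong (_+ F (suc n) q) (Σ₂-eval n F q)

  X₂-zero : ∀ p → X₂ p 0 ≡ 0#
  X₂-zero p = P.trans (v-times (Bu ⊛₂ Buv) p 0) (zeroˡ ((Bu ⊛₂ Buv) p 0))

  X₂-suc : ∀ p q → X₂ p (suc q) ≡ ιR (suc q) * W p q
  X₂-suc p q = P.trans (v-times (Bu ⊛₂ Buv) p (suc q))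
                       (P.trans (conv-𝕩 q ((Bu ⊛₂ Buv) p)) (cong (ιR (suc q) *_) (Bu-Buv p q)))

  X₃-transpose : ∀ p q → X₃ p q ≡ X₂ q p
  X₃-transpose zero    q = P.trans (u-times-zero (Bv ⊛₂ Buv) q) (P.sym (X₂-zero q))
  X₃-transpose (suc p) q = begin
    X₃ (suc p) q
      ≡⟨ u-times-suc (Bv ⊛₂ Buv) p q ⟩
    ιR (suc p) * (Bv ⊛₂ Buv) p q
      ≡⟨ cong (ιR (suc p) *_) (P.trans (Bv-times Buv p q) (conv-binom q B (Buv p))) ⟩
    ιR (suc p) * Σ q (λ j → ιR (q C j) * (B j * B (p ℕ.+ (q ∸ j))))
      ≡⟨ cong (ιR (suc p) *_) (Σ-cong′ q (λ j → cong (λ z → ιR (q C j) * (B j * B z)) (ℕP.+-comm p (q ∸ j)))) ⟩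
    ιR (suc p) * W q p
      ≡⟨ X₂-suc q p ⟨
    X₂ q (suc p) ∎

-- Comparing the coefficients of total degree K′+1 in the two-variable identity:
-- if B_{K′-1} = 0 then (K′+2) Σ_{a≤K′} Bₐ B_{K′-a} = 2 Σ_{a≤K′} C(K′+2, a) Bₐ B_{K′-a}.
module ConvolutionIdentity where

  open Bernoulli
  open TwoVariable
  open CommutativeRing ℚ-ring hiding (zero)
  open P using (cong; cong₂)
  open P.≡-Reasoning

  module Diagonal (K′ : ℕ) where

    K : ℕ
    K = suc K′

    X : ℕ → ℚ
    X a = B a * B (K′ ∸ a)

    X-sym : ∀ a → a ≤ K′ → X (K′ ∸ a) ≡ X a
    X-sym a a≤ = P.trans (cong (λ z → B (K′ ∸ a) * B z) (ℕP.m∸[m∸n]≡n a≤)) (*-comm (B (K′ ∸ a)) (B a))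

    diagonal : Seq₂ → ℚ
    diagonal F = Σ K (λ p → F p (K ∸ p))

    -- Pairing a with K′ - a turns the weights a+1 and K′-a+1 into K′+2.
    paired-weights : Σ K′ (λ a → ιR (suc a) * X a) + Σ K′ (λ a → ιR (suc a) * X a) ≡ ιR (suc K) * Σ K′ X
    paired-weights = begin
      S + S
        ≡⟨ cong (S +_) (P.trans (Σ-rev K′ _) (Σ-cong K′ (λ a a≤ → cong (ιR (suc (K′ ∸ a)) *_) (X-sym a a≤)))) ⟩
      S + Σ K′ (λ a → ιR (suc (K′ ∸ a)) * X a)
        ≡⟨ Σ-+ K′ _ _ ⟨
      Σ K′ (λ a → ιR (suc a) * X a + ιR (suc (K′ ∸ a)) * X a)
        ≡⟨ Σ-cong K′ combine ⟩
      Σ K′ (λ a → ιR (suc K) * X a)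
        ≡⟨ Σ-*ˡ K′ (ιR (suc K)) X ⟨
      ιR (suc K) * Σ K′ X ∎
      where
      S = Σ K′ (λ a → ιR (suc a) * X a)
      weights : ∀ a → a ≤ K′ → suc a ℕ.+ suc (K′ ∸ a) ≡ suc K
      weights a a≤ = cong suc (P.trans (ℕP.+-suc a (K′ ∸ a)) (cong suc (ℕP.m+[n∸m]≡n a≤)))
      combine : ∀ a → a ≤ K′ → ιR (suc a) * X a + ιR (suc (K′ ∸ a)) * X a ≡ ιR (suc K) * X a
      combine a a≤ = begin
        ιR (suc a) * X a + ιR (suc (K′ ∸ a)) * X a ≡⟨ distribʳ (X a) (ιR (suc a)) (ιR (suc (K′ ∸ a))) ⟨
        (ιR (suc a) + ιR (suc (K′ ∸ a))) * X a     ≡⟨ cong (_* X a) (ιR-+ (suc a) (suc (K′ ∸ a))) ⟨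
        ιR (suc a ℕ.+ suc (K′ ∸ a)) * X a          ≡⟨ cong (_* X a) (ιR-cong (weights a a≤)) ⟩
        ιR (suc K) * X a                           ∎

    diagonal-lhs : diagonal lhs ≡ ιR (suc K) * Σ K′ X
    diagonal-lhs = begin
      diagonal lhs
        ≡⟨ Σ-cong′ K (λ p → lhs-coeff p (K ∸ p)) ⟩
      Σ K (λ p → xB p * B (K ∸ p) + B p * xB (K ∸ p))
        ≡⟨ Σ-+ K _ _ ⟩
      Σ K (λ p → xB p * B (K ∸ p)) + Σ K (λ p → B p * xB (K ∸ p))
        ≡⟨ cong (Σ K (λ p → xB p * B (K ∸ p)) +_) reversed ⟩
      Σ K (λ p → xB p * B (K ∸ p)) + Σ K (λ p → xB p * B (K ∸ p))
        ≡⟨ cong₂ _+_ shifted shifted ⟩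
      Σ K′ (λ a → ιR (suc a) * X a) + Σ K′ (λ a → ιR (suc a) * X a)
        ≡⟨ paired-weights ⟩
      ιR (suc K) * Σ K′ X ∎
      where
      reversed : Σ K (λ p → B p * xB (K ∸ p)) ≡ Σ K (λ p → xB p * B (K ∸ p))
      reversed = P.trans (Σ-rev K _) (Σ-cong K (λ p p≤ → P.trans (cong (λ z → B (K ∸ p) * xB z) (ℕP.m∸[m∸n]≡n p≤)) (*-comm (B (K ∸ p)) (xB p))))
      shifted : Σ K (λ p → xB p * B (K ∸ p)) ≡ Σ K′ (λ a → ιR (suc a) * X a)
      shifted = begin
        Σ K (λ p → xB p * B (K ∸ p))                       ≡⟨ Σ-first K′ _ ⟩
        xB 0 * B K + Σ K′ (λ a → xB (suc a) * B (K′ ∸ a))  ≡⟨ cong₂ _+_ (P.trans (cong (_* B K) (zeroˡ (B 0))) (zeroˡ (B K)))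
                                                                      (Σ-cong′ K′ (λ a → P.trans (cong (_* B (K′ ∸ a)) (xB-suc a)) (*-assoc (ιR (suc a)) (B a) (B (K′ ∸ a))))) ⟩
        0# + Σ K′ (λ a → ιR (suc a) * X a)                 ≡⟨ +-identityˡ _ ⟩
        Σ K′ (λ a → ιR (suc a) * X a)                      ∎

    diagonal-rhs : diagonal rhs ≡ diagonal X₁ + diagonal X₂ + diagonal X₃
    diagonal-rhs = P.trans (Σ-cong′ K (λ p → rhs-split p (K ∸ p)))
                           (P.trans (Σ-+ K _ _) (cong (_+ diagonal X₃) (Σ-+ K _ _)))

    -- On the diagonal every coefficient of uv B(u+v) is a multiple of B_{K′-1}.
    diagonal-X₁ : B (K′ ∸ 1) ≡ 0# → diagonal X₁ ≡ 0#
    diagonal-X₁ B-vanishes = Σ-0 K _ vanish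
      where
      vanish : ∀ p → p ≤ K → X₁ p (K ∸ p) ≡ 0#
      vanish zero    _          = X₁-zero K
      vanish (suc p) (s≤s p≤K′) with K′ ∸ p in eq
      ... | zero  = X₁-suc-zero p
      ... | suc q = begin
        X₁ (suc p) (suc q)                        ≡⟨ X₁-suc-suc p q ⟩
        ιR (suc p) * (ιR (suc q) * B (p ℕ.+ q))   ≡⟨ cong (λ z → ιR (suc p) * (ιR (suc q) * B z)) index ⟩
        ιR (suc p) * (ιR (suc q) * B (K′ ∸ 1))    ≡⟨ cong (λ z → ιR (suc p) * (ιR (suc q) * z)) B-vanishes ⟩
        ιR (suc p) * (ιR (suc q) * 0#)            ≡⟨ P.trans (cong (ιR (suc p) *_) (zeroʳ (ιR (suc q)))) (zeroʳ (ιR (suc p))) ⟩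
        0#                                        ∎
        where
        index : p ℕ.+ q ≡ K′ ∸ 1
        index = P.sym (P.trans (cong (_∸ 1) (P.sym (ℕP.m+[n∸m]≡n p≤K′)))
                               (P.trans (cong (λ z → (p ℕ.+ z) ∸ 1) eq) (cong (_∸ 1) (ℕP.+-suc p q))))

    diagonal-X₃ : diagonal X₃ ≡ diagonal X₂
    diagonal-X₃ = begin
      Σ K (λ p → X₃ p (K ∸ p))             ≡⟨ Σ-cong′ K (λ p → X₃-transpose p (K ∸ p)) ⟩
      Σ K (λ p → X₂ (K ∸ p) p)             ≡⟨ Σ-rev K _ ⟩
      Σ K (λ p → X₂ (K ∸ (K ∸ p)) (K ∸ p)) ≡⟨ Σ-cong K (λ p p≤ → cong (λ z → X₂ z (K ∸ p)) (ℕP.m∸[m∸n]≡n p≤)) ⟩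
      Σ K (λ p → X₂ p (K ∸ p))             ∎

    W-diagonal : ∀ p → p ≤ K′ → W p (K′ ∸ p) ≡ Σ K′ (λ i → ιR (p C i) * X i)
    W-diagonal p p≤ = begin
      Σ p (λ i → ιR (p C i) * (B i * B ((p ∸ i) ℕ.+ (K′ ∸ p))))
        ≡⟨ Σ-cong p (λ i i≤ → cong (λ z → ιR (p C i) * (B i * B z)) (index i i≤)) ⟩
      Σ p (λ i → ιR (p C i) * X i)
        ≡⟨ Σ-extend p K′ _ p≤ (λ k p<k → P.trans (cong (λ z → ιR z * X k) (k>n⇒nCk≡0 p<k)) (zeroˡ (X k))) ⟨
      Σ K′ (λ i → ιR (p C i) * X i) ∎
      where
      index : ∀ i → i ≤ p → (p ∸ i) ℕ.+ (K′ ∸ p) ≡ K′ ∸ i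
      index i i≤ = P.trans (P.sym (ℕP.+-∸-comm (K′ ∸ p) i≤)) (cong (_∸ i) (ℕP.m+[n∸m]≡n p≤))

    -- Exchanging the two sums and applying the weighted hockey stick, then symmetry a ↦ K′ - a.
    diagonal-X₂ : diagonal X₂ ≡ Σ K′ (λ i → ιR (suc K C i) * X i)
    diagonal-X₂ = begin
      Σ K (λ p → X₂ p (K ∸ p))
        ≡⟨ Σ-last0 K′ _ (P.trans (cong (X₂ K) (ℕP.n∸n≡0 K′)) (X₂-zero K)) ⟩
      Σ K′ (λ p → X₂ p (K ∸ p))
        ≡⟨ Σ-cong K′ (λ p p≤ → P.trans (cong (X₂ p) (ℕP.+-∸-assoc 1 p≤))
                                       (P.trans (X₂-suc p (K′ ∸ p)) (cong (ιR (suc (K′ ∸ p)) *_) (W-diagonal p p≤)))) ⟩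
      Σ K′ (λ p → ιR (suc (K′ ∸ p)) * Σ K′ (λ i → ιR (p C i) * X i))
        ≡⟨ Σ-cong′ K′ (λ p → Σ-*ˡ K′ (ιR (suc (K′ ∸ p))) (λ i → ιR (p C i) * X i)) ⟩
      Σ K′ (λ p → Σ K′ (λ i → ιR (suc (K′ ∸ p)) * (ιR (p C i) * X i)))
        ≡⟨ Σ-swap K′ K′ _ ⟩
      Σ K′ (λ i → Σ K′ (λ p → ιR (suc (K′ ∸ p)) * (ιR (p C i) * X i)))
        ≡⟨ Σ-cong′ K′ pull-out-X ⟩
      Σ K′ (λ i → Σ K′ (λ p → ιR (suc (K′ ∸ p)) * ιR (p C i)) * X i)
        ≡⟨ Σ-cong′ K′ (λ i → cong (_* X i) (weighted-hockey-stick K′ i)) ⟩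
      Σ K′ (λ i → ιR (suc K C suc (suc i)) * X i)
        ≡⟨ Σ-rev K′ _ ⟩
      Σ K′ (λ i → ιR (suc K C suc (suc (K′ ∸ i))) * X (K′ ∸ i))
        ≡⟨ Σ-cong K′ (λ i i≤ → cong₂ _*_ (ιR-cong (complement i i≤)) (X-sym i i≤)) ⟩
      Σ K′ (λ i → ιR (suc K C i) * X i) ∎
      where
      pull-out-X : ∀ i → Σ K′ (λ p → ιR (suc (K′ ∸ p)) * (ιR (p C i) * X i))
                         ≡ Σ K′ (λ p → ιR (suc (K′ ∸ p)) * ιR (p C i)) * X i
      pull-out-X i = P.trans (Σ-cong′ K′ (λ p → P.sym (*-assoc (ιR (suc (K′ ∸ p))) (ιR (p C i)) (X i))))
                             (P.sym (Σ-*ʳ K′ (X i) (λ p → ιR (suc (K′ ∸ p)) * ιR (p C i))))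
      complement : ∀ i → i ≤ K′ → suc K C suc (suc (K′ ∸ i)) ≡ suc K C i
      complement i i≤ = P.trans (nCk≡nC[n∸k] (s≤s (s≤s (ℕP.m∸n≤m K′ i)))) (cong (suc K C_) (ℕP.m∸[m∸n]≡n i≤))

  convolution-identity : ∀ K′ → B (K′ ∸ 1) ≡ 0# →
    ιR (suc (suc K′)) * Σ K′ (λ a → B a * B (K′ ∸ a))
      ≡ Σ K′ (λ a → ιR (suc (suc K′) C a) * (B a * B (K′ ∸ a))) + Σ K′ (λ a → ιR (suc (suc K′) C a) * (B a * B (K′ ∸ a)))
  convolution-identity K′ B-vanishes = begin
    ιR (suc K) * Σ K′ X                             ≡⟨ diagonal-lhs ⟨
    diagonal lhs                                    ≡⟨ Σ-cong′ K (λ p → product-identity p (K ∸ p)) ⟩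
    diagonal rhs                                    ≡⟨ diagonal-rhs ⟩
    diagonal X₁ + diagonal X₂ + diagonal X₃         ≡⟨ cong₂ (λ x y → x + diagonal X₂ + y) (diagonal-X₁ B-vanishes) diagonal-X₃ ⟩
    0# + diagonal X₂ + diagonal X₂                  ≡⟨ cong (_+ diagonal X₂) (+-identityˡ (diagonal X₂)) ⟩
    diagonal X₂ + diagonal X₂                       ≡⟨ cong₂ _+_ diagonal-X₂ diagonal-X₂ ⟩
    Σ K′ (λ a → ιR (suc K C a) * X a) + Σ K′ (λ a → ιR (suc K C a) * X a) ∎
    where open Diagonal K′

module Binomial where

  open P using (cong; cong₂)
  open P.≡-Reasoning
  open import Data.Nat.Solver using (module +-*-Solver)
  open +-*-Solver using (solve; _:+_; _:*_; _:=_; con)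

  absorb : ∀ n k → suc k ℕ.* (suc n C suc k) ≡ suc n ℕ.* (n C k)
  absorb zero    zero    = P.refl
  absorb zero    (suc k) = ℕP.*-zeroʳ (suc (suc k))
  absorb (suc n) zero    = P.trans (ℕP.*-identityˡ _) (P.trans (nC1≡n (suc (suc n))) (P.sym (ℕP.*-identityʳ _)))
  absorb (suc n) (suc k) = begin
    suc (suc k) ℕ.* (suc (suc n) C suc (suc k))      ≡⟨ cong (suc (suc k) ℕ.*_) (nCk+nC[k+1]≡[n+1]C[k+1] (suc n) (suc k)) ⟨
    suc (suc k) ℕ.* (a ℕ.+ b)                          ≡⟨ solve 3 (λ k a b → (con 2 :+ k) :* (a :+ b) := (con 1 :+ k) :* a :+ a :+ (con 2 :+ k) :* b) P.refl k a b ⟩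
    suc k ℕ.* a ℕ.+ a ℕ.+ suc (suc k) ℕ.* b            ≡⟨ cong₂ (λ x y → x ℕ.+ a ℕ.+ y) (absorb n k) (absorb n (suc k)) ⟩
    suc n ℕ.* (n C k) ℕ.+ a ℕ.+ suc n ℕ.* (n C suc k)  ≡⟨ solve 4 (λ n a c₀ c₁ → (con 1 :+ n) :* c₀ :+ a :+ (con 1 :+ n) :* c₁
                                                                      := (con 1 :+ n) :* (c₀ :+ c₁) :+ a) P.refl n a (n C k) (n C suc k) ⟩
    suc n ℕ.* (n C k ℕ.+ n C suc k) ℕ.+ a              ≡⟨ cong (λ z → suc n ℕ.* z ℕ.+ a) (nCk+nC[k+1]≡[n+1]C[k+1] n k) ⟩
    suc n ℕ.* a ℕ.+ a                                  ≡⟨ solve 2 (λ n a → (con 1 :+ n) :* a :+ a := (con 2 :+ n) :* a) P.refl n a ⟩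
    suc (suc n) ℕ.* a                                  ∎
    where
    a = suc n C suc k
    b = suc n C suc (suc k)

  absorb′ : ∀ m a → a ≤ m → (suc m C a) ℕ.* (suc m ∸ a) ≡ suc m ℕ.* (m C a)
  absorb′ m a a≤ = begin
    (suc m C a) ℕ.* (suc m ∸ a)                ≡⟨ cong₂ ℕ._*_ (P.trans (nCk≡nC[n∸k] (ℕP.m≤n⇒m≤1+n a≤)) (cong (suc m C_) m+1∸a)) m+1∸a ⟩
    (suc m C suc (m ∸ a)) ℕ.* suc (m ∸ a)      ≡⟨ ℕP.*-comm (suc m C suc (m ∸ a)) (suc (m ∸ a)) ⟩
    suc (m ∸ a) ℕ.* (suc m C suc (m ∸ a))      ≡⟨ absorb m (m ∸ a) ⟩
    suc m ℕ.* (m C (m ∸ a))                    ≡⟨ cong (suc m ℕ.*_) (nCk≡nC[n∸k] a≤) ⟨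
    suc m ℕ.* (m C a)                          ∎
    where
    m+1∸a : suc m ∸ a ≡ suc (m ∸ a)
    m+1∸a = ℕP.+-∸-assoc 1 a≤

  choose-two : ∀ s → 2 ℕ.* (suc (suc s) C s) ≡ suc (suc s) ℕ.* suc s
  choose-two s = begin
    2 ℕ.* (suc (suc s) C s) ≡⟨ cong (2 ℕ.*_) (P.trans (nCk≡nC[n∸k] (ℕP.≤-trans (ℕP.n≤1+n s) (ℕP.n≤1+n (suc s)))) (cong (suc (suc s) C_) (s+2∸s s))) ⟩
    2 ℕ.* (suc (suc s) C 2) ≡⟨ absorb (suc s) 1 ⟩
    suc (suc s) ℕ.* (suc s C 1) ≡⟨ cong (suc (suc s) ℕ.*_) (nC1≡n (suc s)) ⟩
    suc (suc s) ℕ.* suc s   ∎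
    where
    s+2∸s : ∀ s → suc (suc s) ∸ s ≡ 2
    s+2∸s zero    = P.refl
    s+2∸s (suc s) = s+2∸s s

module Parity where

  open import Data.Product using (∃)
  open import Data.Sum using (_⊎_; inj₁; inj₂)
  open P using (cong)

  parity : ∀ n → (∃ λ k → n ≡ k ℕ.+ k) ⊎ (∃ λ k → n ≡ suc (k ℕ.+ k))
  parity zero = inj₁ (0 , P.refl)
  parity (suc n) with parity n
  ... | inj₁ (k , e) = inj₂ (k , cong suc e)
  ... | inj₂ (k , e) = inj₁ (suc k , P.trans (cong suc e) (cong suc (P.sym (ℕP.+-suc k k))))

  even≢odd : ∀ x y → x ℕ.+ x ≢ suc (y ℕ.+ y)
  even≢odd zero    y       ()
  even≢odd (suc x) zero    e with P.trans (P.sym (ℕP.+-suc x x)) (ℕP.suc-injective e)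
  ... | ()
  even≢odd (suc x) (suc y) e = even≢odd x y (ℕP.suc-injective (P.trans (P.sym (ℕP.+-suc x x))
                                 (P.trans (ℕP.suc-injective e) (cong suc (ℕP.+-suc y y)))))

  even%2 : ∀ k → (k ℕ.+ k) % 2 ≡ 0
  even%2 zero    = P.refl
  even%2 (suc k) rewrite ℕP.+-suc k k = even%2 k

-- For m = 2j + 5 and a sequence b vanishing at the odd indices ≥ 3, a product
-- bᵣ bₗ bₖ with r + l + k = m vanishes unless exactly one index equals 1.  Hence
-- a triple sum Σ_{r+l+k=m} c(r,l) bᵣ bₗ bₖ collapses to three single sums.
module TripleSum (b : ℕ → ℚ) (b-odd : ∀ k → b (suc (suc (suc (k ℕ.+ k)))) ≡ 0ℚ) (j : ℕ) where

  open import Data.Sum using (inj₁; inj₂)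
  open Parity
  open Bernoulli using (ℚ-ring; ιR-inv)
  open Rationals using (inv)
  open FiniteSums ℚ-ring
  open CommutativeRing ℚ-ring hiding (zero)
  open P using (cong; cong₂)
  open P.≡-Reasoning
  open Binomial using (choose-two)
  import Algebra.Solver.Ring.NaturalCoefficients.Default as NatSolver
  open NatSolver commutativeSemiring using (solve; _:*_; _:=_)

  M m n : ℕ
  M = suc (suc (suc (suc (j ℕ.+ j))))
  m = suc M
  n = suc m

  δ₁ : ℕ → ℚ
  δ₁ zero          = 0#
  δ₁ (suc zero)    = 1#
  δ₁ (suc (suc n)) = 0#

  δ₁-≢1 : ∀ x → x ≢ 1 → δ₁ x ≡ 0#
  δ₁-≢1 zero          _  = P.refl
  δ₁-≢1 (suc zero)    ne = ⊥-elim (ne P.refl)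
  δ₁-≢1 (suc (suc x)) _  = P.refl

  b-odd-index : ∀ x k → x ≡ suc (k ℕ.+ k) → x ≢ 1 → b x ≡ 0#
  b-odd-index x zero    e ne = ⊥-elim (ne e)
  b-odd-index x (suc k) e ne = P.trans (cong b (P.trans e (cong (λ z → suc (suc z)) (ℕP.+-suc k k)))) (b-odd k)

  -- If no index is 1, one of them is odd (m is odd) and at least 3.
  none-is-1 : ∀ r l k → r ℕ.+ l ℕ.+ k ≡ m → r ≢ 1 → l ≢ 1 → k ≢ 1 → b r * b l * b k ≡ 0#
  none-is-1 r l k e nr nl nk with parity r | parity l | parity k
  ... | inj₂ (x , er) | _ | _ =
    P.trans (cong (λ z → z * b l * b k) (b-odd-index r x er nr)) (P.trans (cong (_* b k) (zeroˡ (b l))) (zeroˡ (b k)))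
  ... | inj₁ _ | inj₂ (y , el) | _ =
    P.trans (cong (λ z → b r * z * b k) (b-odd-index l y el nl)) (P.trans (cong (_* b k) (zeroʳ (b r))) (zeroˡ (b k)))
  ... | inj₁ _ | inj₁ _ | inj₂ (z , ek) =
    P.trans (cong (λ w → b r * b l * w) (b-odd-index k z ek nk)) (zeroʳ (b r * b l))
  ... | inj₁ (x , er) | inj₁ (y , el) | inj₁ (z , ek) =
    ⊥-elim (even≢odd (x ℕ.+ y ℕ.+ z) (suc (suc j)) (P.trans regroup (P.trans e m-odd)))
    where
    open import Data.Nat.Solver using (module +-*-Solver)
    open +-*-Solver using () renaming (solve to solve-ℕ; _:+_ to _⊕_; _:=_ to _≐_)
    regroup : x ℕ.+ y ℕ.+ z ℕ.+ (x ℕ.+ y ℕ.+ z) ≡ r ℕ.+ l ℕ.+ k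
    regroup = P.trans (solve-ℕ 3 (λ x y z → x ⊕ y ⊕ z ⊕ (x ⊕ y ⊕ z) ≐ (x ⊕ x) ⊕ (y ⊕ y) ⊕ (z ⊕ z)) P.refl x y z)
                      (P.sym (cong₂ ℕ._+_ (cong₂ ℕ._+_ er el) ek))
    m-odd : m ≡ suc (suc (suc j) ℕ.+ suc (suc j))
    m-odd = cong (λ w → suc (suc (suc w))) (P.sym (P.trans (ℕP.+-suc j (suc j)) (cong suc (ℕP.+-suc j j))))

  -- If the other two indices sum to M, an index 1 forces the partner index M - 1 ≥ 3 (odd).
  δ₁-partner : ∀ x y → x ℕ.+ y ≡ M → δ₁ x * b y ≡ 0#
  δ₁-partner x y e with x ℕ.≟ 1
  ... | yes P.refl = P.trans (*-identityˡ (b y)) (P.trans (cong b (ℕP.suc-injective e)) (b-odd j))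
  ... | no  x≢1    = P.trans (cong (_* b y) (δ₁-≢1 x x≢1)) (zeroˡ (b y))

  split : ℕ → ℕ → ℕ → ℚ
  split r l k = δ₁ r * (b 1 * (b l * b k)) + δ₁ l * (b 1 * (b r * b k)) + δ₁ k * (b 1 * (b r * b l))

  only-first : ∀ {x y z w} → x ≡ w → y ≡ 0# → z ≡ 0# → x + y + z ≡ w
  only-first {x} P.refl P.refl P.refl = P.trans (+-identityʳ (x + 0#)) (+-identityʳ x)

  only-second : ∀ {x y z w} → x ≡ 0# → y ≡ w → z ≡ 0# → x + y + z ≡ w
  only-second {y = y} P.refl P.refl P.refl = P.trans (+-identityʳ (0# + y)) (+-identityˡ y)

  only-third : ∀ {x y z w} → x ≡ 0# → y ≡ 0# → z ≡ w → x + y + z ≡ w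
  only-third {z = z} P.refl P.refl P.refl = P.trans (cong (_+ z) (+-identityʳ 0#)) (+-identityˡ z)

  term-vanishesˡ : ∀ x c d → δ₁ x * c ≡ 0# → δ₁ x * (b 1 * (c * d)) ≡ 0#
  term-vanishesˡ x c d δc≡0 = begin
    δ₁ x * (b 1 * (c * d)) ≡⟨ solve 4 (λ δ a c d → δ :* (a :* (c :* d)) := (δ :* c) :* (a :* d)) P.refl (δ₁ x) (b 1) c d ⟩
    (δ₁ x * c) * (b 1 * d) ≡⟨ P.trans (cong (_* (b 1 * d)) δc≡0) (zeroˡ (b 1 * d)) ⟩
    0#                     ∎

  term-vanishesʳ : ∀ x c d → δ₁ x * d ≡ 0# → δ₁ x * (b 1 * (c * d)) ≡ 0#
  term-vanishesʳ x c d δd≡0 = P.trans (cong (λ z → δ₁ x * (b 1 * z)) (*-comm c d)) (term-vanishesˡ x d c δd≡0)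

  term-vanishes-≢1 : ∀ x t → x ≢ 1 → δ₁ x * t ≡ 0#
  term-vanishes-≢1 x t x≢1 = P.trans (cong (_* t) (δ₁-≢1 x x≢1)) (zeroˡ t)

  decomposition : ∀ r l k → r ℕ.+ l ℕ.+ k ≡ m → b r * b l * b k ≡ split r l k
  decomposition r l k e with r ℕ.≟ 1
  ... | yes P.refl = begin
    b 1 * b l * b k   ≡⟨ *-assoc (b 1) (b l) (b k) ⟩
    b 1 * (b l * b k) ≡⟨ only-first (*-identityˡ _)
                           (term-vanishesʳ l (b 1) (b k) (δ₁-partner l k (ℕP.suc-injective e)))
                           (term-vanishesʳ k (b 1) (b l) (δ₁-partner k l (P.trans (ℕP.+-comm k l) (ℕP.suc-injective e)))) ⟨
    split 1 l k       ∎
  ... | no r≢1 with l ℕ.≟ 1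
  ...   | yes P.refl = begin
    b r * b 1 * b k   ≡⟨ P.trans (cong (_* b k) (*-comm (b r) (b 1))) (*-assoc (b 1) (b r) (b k)) ⟩
    b 1 * (b r * b k) ≡⟨ only-second (term-vanishes-≢1 r _ r≢1) (*-identityˡ _)
                           (term-vanishesˡ k (b r) (b 1) (δ₁-partner k r (P.trans (ℕP.+-comm k r) rk≡M))) ⟨
    split r 1 k       ∎
    where
    rk≡M : r ℕ.+ k ≡ M
    rk≡M = ℕP.suc-injective (P.trans (P.sym (cong (ℕ._+ k) (ℕP.+-comm r 1))) e)
  ...   | no l≢1 with k ℕ.≟ 1
  ...     | yes P.refl = begin
    b r * b l * b 1   ≡⟨ *-comm (b r * b l) (b 1) ⟩
    b 1 * (b r * b l) ≡⟨ only-third (term-vanishes-≢1 r _ r≢1) (term-vanishes-≢1 l _ l≢1) (*-identityˡ _) ⟨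
    split r l 1       ∎
  ...     | no k≢1 = begin
    b r * b l * b k   ≡⟨ none-is-1 r l k e r≢1 l≢1 k≢1 ⟩
    0#                ≡⟨ only-third (term-vanishes-≢1 r _ r≢1) (term-vanishes-≢1 l _ l≢1) (term-vanishes-≢1 k _ k≢1) ⟨
    split r l k       ∎

  c : ℕ → ℕ → ℚ
  c r l = ιR ((n C r) ℕ.* ((n ∸ r) C l)) * inv (m ∸ r)

  triple : ℚ
  triple = Σ m (λ r → Σ (m ∸ r) (λ l → c r l * b r * b l * b (m ∸ r ∸ l)))

  X : ℕ → ℚ
  X a = b a * b (M ∸ a)

  W U D : ℚ
  W = Σ M (λ a → ιR (m C a) * X a)
  U = Σ M (λ a → ιR (n C a) * X a)
  D = Σ M (λ a → ιR (n C a) * ιR (suc (M ∸ a)) * X a)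

  t₁ t₂ t₃ : ℕ → ℕ → ℚ
  t₁ r l = c r l * (δ₁ r * (b 1 * (b l * b (m ∸ r ∸ l))))
  t₂ r l = c r l * (δ₁ l * (b 1 * (b r * b (m ∸ r ∸ l))))
  t₃ r l = c r l * (δ₁ (m ∸ r ∸ l) * (b 1 * (b r * b l)))

  T₁ T₂ T₃ : ℚ
  T₁ = Σ m (λ r → Σ (m ∸ r) (t₁ r))
  T₂ = Σ m (λ r → Σ (m ∸ r) (t₂ r))
  T₃ = Σ m (λ r → Σ (m ∸ r) (t₃ r))

  triple-split : triple ≡ T₁ + T₂ + T₃
  triple-split = begin
    triple
      ≡⟨ Σ-cong m (λ r r≤ → Σ-cong (m ∸ r) (λ l l≤ → summand r l r≤ l≤)) ⟩
    Σ m (λ r → Σ (m ∸ r) (λ l → t₁ r l + t₂ r l + t₃ r l))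
      ≡⟨ Σ-cong′ m (λ r → P.trans (Σ-+ (m ∸ r) _ _) (cong (_+ Σ (m ∸ r) (t₃ r)) (Σ-+ (m ∸ r) _ _))) ⟩
    Σ m (λ r → Σ (m ∸ r) (t₁ r) + Σ (m ∸ r) (t₂ r) + Σ (m ∸ r) (t₃ r))
      ≡⟨ P.trans (Σ-+ m _ _) (cong (_+ T₃) (Σ-+ m _ _)) ⟩
    T₁ + T₂ + T₃ ∎
    where
    summand : ∀ r l → r ≤ m → l ≤ m ∸ r → c r l * b r * b l * b (m ∸ r ∸ l) ≡ t₁ r l + t₂ r l + t₃ r l
    summand r l r≤ l≤ = begin
      c r l * b r * b l * b k              ≡⟨ P.trans (cong (_* b k) (*-assoc (c r l) (b r) (b l))) (*-assoc (c r l) (b r * b l) (b k)) ⟩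
      c r l * (b r * b l * b k)            ≡⟨ cong (c r l *_) (decomposition r l k indices) ⟩
      c r l * split r l k                  ≡⟨ P.trans (distribˡ (c r l) _ _) (cong (_+ t₃ r l) (distribˡ (c r l) _ _)) ⟩
      t₁ r l + t₂ r l + t₃ r l             ∎
      where
      k = m ∸ r ∸ l
      indices : r ℕ.+ l ℕ.+ k ≡ m
      indices = P.trans (ℕP.+-assoc r l k) (P.trans (cong (r ℕ.+_) (ℕP.m+[n∸m]≡n l≤)) (ℕP.m+[n∸m]≡n r≤))

  times-δ-zero : ∀ x t u → x ≢ 1 → u * (δ₁ x * t) ≡ 0#
  times-δ-zero x t u x≢1 = P.trans (cong (u *_) (term-vanishes-≢1 x t x≢1)) (zeroʳ u)

  m∸r : ∀ r → r ≤ M → m ∸ r ≡ suc (M ∸ r)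
  m∸r r r≤ = ℕP.+-∸-assoc 1 r≤

  n∸r : ∀ r → r ≤ M → n ∸ r ≡ suc (suc (M ∸ r))
  n∸r r r≤ = P.trans (ℕP.+-∸-assoc 1 (ℕP.m≤n⇒m≤1+n r≤)) (cong suc (m∸r r r≤))

  -- h = 1/2 = -B₁.
  h : ℚ
  h = inv 1

  c-first : ∀ l → c 1 l ≡ ιR n * inv M * ιR (m C l)
  c-first l = begin
    ιR ((n C 1) ℕ.* (m C l)) * inv M  ≡⟨ cong (_* inv M) (P.trans (ιR-cong (cong (ℕ._* (m C l)) (nC1≡n n))) (ιR-* n (m C l))) ⟩
    ιR n * ιR (m C l) * inv M         ≡⟨ xy∙z≈xz∙y (ιR n) (ιR (m C l)) (inv M) ⟩
    ιR n * inv M * ιR (m C l)         ∎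
    where open import Algebra.Properties.CommutativeSemigroup *-commutativeSemigroup using (xy∙z≈xz∙y)

  c-second : ∀ r → r ≤ M → c r 1 ≡ ιR (n C r)
  c-second r r≤ = begin
    ιR ((n C r) ℕ.* ((n ∸ r) C 1)) * inv (m ∸ r)     ≡⟨ cong (λ z → ιR ((n C r) ℕ.* z) * inv (m ∸ r)) (P.trans (nC1≡n (n ∸ r)) (ℕP.+-∸-assoc 1 (ℕP.m≤n⇒m≤1+n r≤))) ⟩
    ιR ((n C r) ℕ.* suc (m ∸ r)) * inv (m ∸ r)       ≡⟨ cong (_* inv (m ∸ r)) (ιR-* (n C r) (suc (m ∸ r))) ⟩
    ιR (n C r) * ιR (suc (m ∸ r)) * inv (m ∸ r)      ≡⟨ *-assoc (ιR (n C r)) (ιR (suc (m ∸ r))) (inv (m ∸ r)) ⟩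
    ιR (n C r) * (ιR (suc (m ∸ r)) * inv (m ∸ r))    ≡⟨ cong (ιR (n C r) *_) (ιR-inv (m ∸ r)) ⟩
    ιR (n C r) * 1#                                  ≡⟨ *-identityʳ _ ⟩
    ιR (n C r)                                       ∎

  -- c(r, M - r) = C(n, r) (M-r+1) / 2, since C(s+2, s)/(s+2) = (s+1)/2.
  c-third : ∀ r → r ≤ M → c r (M ∸ r) ≡ h * (ιR (n C r) * ιR (suc (M ∸ r)))
  c-third r r≤ = begin
    ιR ((n C r) ℕ.* ((n ∸ r) C s)) * inv (m ∸ r)     ≡⟨ cong₂ (λ x y → ιR ((n C r) ℕ.* (x C s)) * inv y) (n∸r r r≤) (m∸r r r≤) ⟩
    ιR ((n C r) ℕ.* (suc (suc s) C s)) * inv (suc s) ≡⟨ cong (_* inv (suc s)) (ιR-* (n C r) _) ⟩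
    ιR (n C r) * ιR (suc (suc s) C s) * inv (suc s)  ≡⟨ *-assoc (ιR (n C r)) (ιR (suc (suc s) C s)) (inv (suc s)) ⟩
    ιR (n C r) * (ιR (suc (suc s) C s) * inv (suc s)) ≡⟨ cong (ιR (n C r) *_) half ⟩
    ιR (n C r) * (h * ιR (suc s))                    ≡⟨ x∙yz≈y∙xz (ιR (n C r)) h (ιR (suc s)) ⟩
    h * (ιR (n C r) * ιR (suc s))                    ∎
    where
    open import Algebra.Properties.CommutativeSemigroup *-commutativeSemigroup using (x∙yz≈y∙xz)
    s = M ∸ r
    two-h : ιR 2 * h ≡ 1#
    two-h = ιR-inv 1
    half : ιR (suc (suc s) C s) * inv (suc s) ≡ h * ιR (suc s)
    half = begin
      ιR C′ * inv (suc s)                              ≡⟨ cong (_* inv (suc s)) (*-identityˡ (ιR C′)) ⟨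
      1# * ιR C′ * inv (suc s)                         ≡⟨ cong (λ z → z * ιR C′ * inv (suc s)) (P.trans (*-comm h (ιR 2)) two-h) ⟨
      h * ιR 2 * ιR C′ * inv (suc s)                   ≡⟨ cong (λ z → z * inv (suc s)) (*-assoc h (ιR 2) (ιR C′)) ⟩
      h * (ιR 2 * ιR C′) * inv (suc s)                 ≡⟨ cong (λ z → h * z * inv (suc s)) (P.trans (P.sym (ιR-* 2 C′)) (P.trans (ιR-cong (choose-two s)) (ιR-* (suc (suc s)) (suc s)))) ⟩
      h * (ιR (suc (suc s)) * ιR (suc s)) * inv (suc s) ≡⟨ solve 4 (λ h a b i → h :* (a :* b) :* i := h :* (a :* i :* b)) P.refl h (ιR (suc (suc s))) (ιR (suc s)) (inv (suc s)) ⟩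
      h * (ιR (suc (suc s)) * inv (suc s) * ιR (suc s)) ≡⟨ cong (λ z → h * (z * ιR (suc s))) (ιR-inv (suc s)) ⟩
      h * (1# * ιR (suc s))                            ≡⟨ cong (h *_) (*-identityˡ (ιR (suc s))) ⟩
      h * ιR (suc s)                                   ∎
      where
      C′ = suc (suc s) C s

  factor-out : ∀ κ t f → (∀ a → a ≤ M → t a ≡ κ * f a) → Σ M t ≡ κ * Σ M f
  factor-out κ t f eq = P.trans (Σ-cong M eq) (P.sym (Σ-*ˡ M κ f))

  last-row-vanishes : ∀ (g : ℕ → ℚ) → g 0 ≡ 0# → Σ (m ∸ m) g ≡ 0#
  last-row-vanishes g g₀ = P.trans (cong (λ z → Σ z g) (ℕP.n∸n≡0 m)) g₀

  -- In T₁ only the row r = 1 survives; in T₂ only l = 1, in T₃ only l = M - r, in each row r ≤ M.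
  T₁≡ : T₁ ≡ (b 1 * (ιR n * inv M)) * W
  T₁≡ = begin
    T₁ ≡⟨ Σ-single m 1 _ (s≤s z≤n) (λ r _ r≢1 → Σ-0 (m ∸ r) _ (λ l _ → times-δ-zero r _ (c r l) r≢1)) ⟩
    Σ M (λ l → c 1 l * (1# * (b 1 * X l)))
      ≡⟨ factor-out (b 1 * (ιR n * inv M)) _ (λ l → ιR (m C l) * X l) (λ l _ → begin
           c 1 l * (1# * (b 1 * X l))                    ≡⟨ cong₂ _*_ (c-first l) (*-identityˡ _) ⟩
           ιR n * inv M * ιR (m C l) * (b 1 * X l)       ≡⟨ solve 5 (λ N i C b x → N :* i :* C :* (b :* x) := b :* (N :* i) :* (C :* x)) P.refl (ιR n) (inv M) (ιR (m C l)) (b 1) (X l) ⟩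
           (b 1 * (ιR n * inv M)) * (ιR (m C l) * X l)   ∎) ⟩
    (b 1 * (ιR n * inv M)) * W ∎

  T₂≡ : T₂ ≡ b 1 * U
  T₂≡ = begin
    Σ M G + G m ≡⟨ cong (Σ M G +_) (last-row-vanishes (λ l → c m l * (δ₁ l * (b 1 * (b m * b (m ∸ m ∸ l))))) (times-δ-zero 0 (b 1 * (b m * b (m ∸ m ∸ 0))) (c m 0) (λ ()))) ⟩
    Σ M G + 0#  ≡⟨ +-identityʳ _ ⟩
    Σ M G       ≡⟨ factor-out (b 1) G (λ r → ιR (n C r) * X r) (λ r r≤ → begin
           G r  ≡⟨ Σ-single (m ∸ r) 1 _ (P.subst (1 ≤_) (P.sym (m∸r r r≤)) (s≤s z≤n)) (λ l _ l≢1 → times-δ-zero l _ (c r l) l≢1) ⟩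
           c r 1 * (1# * (b 1 * (b r * b (m ∸ r ∸ 1))))   ≡⟨ cong₂ (λ x y → x * (1# * (b 1 * (b r * b y)))) (c-second r r≤) (cong (_∸ 1) (m∸r r r≤)) ⟩
           ιR (n C r) * (1# * (b 1 * X r))                ≡⟨ cong (ιR (n C r) *_) (*-identityˡ _) ⟩
           ιR (n C r) * (b 1 * X r)                       ≡⟨ x∙yz≈y∙xz (ιR (n C r)) (b 1) (X r) ⟩
           b 1 * (ιR (n C r) * X r)                       ∎) ⟩
    b 1 * U     ∎
    where
    open import Algebra.Properties.CommutativeSemigroup *-commutativeSemigroup using (x∙yz≈y∙xz)
    G : ℕ → ℚ
    G r = Σ (m ∸ r) (t₂ r)

  T₃≡ : T₃ ≡ (b 1 * h) * D
  T₃≡ = begin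
    Σ M H + H m ≡⟨ cong (Σ M H +_) (last-row-vanishes (λ l → c m l * (δ₁ (m ∸ m ∸ l) * (b 1 * (b m * b l)))) (times-δ-zero (m ∸ m) _ (c m 0) (λ e → 0≢1 (P.trans (P.sym (ℕP.n∸n≡0 m)) e)))) ⟩
    Σ M H + 0#  ≡⟨ +-identityʳ _ ⟩
    Σ M H       ≡⟨ factor-out (b 1 * h) H (λ r → ιR (n C r) * ιR (suc (M ∸ r)) * X r) (λ r r≤ → begin
           H r  ≡⟨ Σ-single (m ∸ r) (M ∸ r) _ (ℕP.∸-monoˡ-≤ r (ℕP.n≤1+n M)) (λ l l≤ l≢ → times-δ-zero (m ∸ r ∸ l) _ (c r l) (λ e → l≢ (partner r r≤ l l≤ e))) ⟩
           c r (M ∸ r) * (δ₁ (m ∸ r ∸ (M ∸ r)) * (b 1 * X r)) ≡⟨ cong (λ z → c r (M ∸ r) * (δ₁ z * (b 1 * X r))) (P.trans (cong (_∸ (M ∸ r)) (m∸r r r≤)) (ℕP.m+n∸n≡m 1 (M ∸ r))) ⟩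
           c r (M ∸ r) * (1# * (b 1 * X r))                  ≡⟨ cong₂ _*_ (c-third r r≤) (*-identityˡ _) ⟩
           h * (ιR (n C r) * ιR (suc (M ∸ r))) * (b 1 * X r) ≡⟨ solve 5 (λ h C s b x → h :* (C :* s) :* (b :* x) := b :* h :* (C :* s :* x)) P.refl h (ιR (n C r)) (ιR (suc (M ∸ r))) (b 1) (X r) ⟩
           (b 1 * h) * (ιR (n C r) * ιR (suc (M ∸ r)) * X r) ∎) ⟩
    (b 1 * h) * D ∎
    where
    H : ℕ → ℚ
    H r = Σ (m ∸ r) (t₃ r)
    0≢1 : 0 ≢ 1
    0≢1 ()
    partner : ∀ r → r ≤ M → ∀ l → l ≤ m ∸ r → m ∸ r ∸ l ≡ 1 → l ≡ M ∸ r
    partner r r≤ l l≤ e = ℕP.suc-injective (P.trans (ℕP.+-comm 1 l)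
                            (P.trans (cong (l ℕ.+_) (P.sym e)) (P.trans (ℕP.m+[n∸m]≡n l≤) (m∸r r r≤))))

  collapse : triple ≡ (b 1 * (ιR n * inv M)) * W + b 1 * U + (b 1 * h) * D
  collapse = P.trans triple-split (cong₂ _+_ (cong₂ _+_ T₁≡ T₂≡) T₃≡)

module Assembly (j : ℕ) where

  open import Data.Integer using (+_)
  open import Data.Rational using (_/_)
  open import Data.Rational.Properties using (_≟_)
  open import Data.Nat.Properties using (m*n≢0)
  open Bernoulli using (ℚ-ring; Σ; ιR; ιR-+; ιR-*; ιR-cong; Σ-cong; Σ-cong′; Σ-*ˡ; Σ-+; ι≡ιR; Σ≡sumTo; ιR-inv; B-odd)
  open Rationals using (inv; /-ι)
  open ConvolutionIdentity using (convolution-identity)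
  open TripleSum B B-odd j
  open CommutativeRing ℚ-ring hiding (zero)
  open P using (cong; cong₂)
  open P.≡-Reasoning
  open import Tactic.RingSolver.Core.AlmostCommutativeRing using (fromCommutativeRing)
  open import Relation.Nullary.Decidable using (dec⇒maybe)
  open import Tactic.RingSolver.NonReflective (fromCommutativeRing ℚ-ring (λ x → dec⇒maybe (0ℚ ≟ x)))
    using (solve; _⊕_; _⊗_; ⊝_; _⊜_)

  N iN iM Z : ℚ
  N  = ιR n
  iN = inv m
  iM = inv M
  Z  = Σ M X

  iN-N : iN * N ≡ 1#
  iN-N = P.trans (*-comm iN N) (ιR-inv m)

  -- (m+1) W = U + D, because C(m,a) (m+1) = C(m+1,a) (m+1-a) and m+1-a = 1 + (M-a+1).
  W≡ : W ≡ iN * (U + D)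
  W≡ = begin
    W                                        ≡⟨ Σ-cong M weights ⟩
    Σ M (λ a → iN * (u a + d a))             ≡⟨ Σ-*ˡ M iN (λ a → u a + d a) ⟨
    iN * Σ M (λ a → u a + d a)               ≡⟨ cong (iN *_) (Σ-+ M u d) ⟩
    iN * (U + D)                             ∎
    where
    open import Tactic.RingSolver.Core.Expression using (Κ)
    u d : ℕ → ℚ
    u a = ιR (n C a) * X a
    d a = ιR (n C a) * ιR (suc (M ∸ a)) * X a
    weights : ∀ a → a ≤ M → ιR (m C a) * X a ≡ iN * (u a + d a)
    weights a a≤ = P.sym (begin
      iN * (Cn * X a + Cn * s * X a)
        ≡⟨ solve 4 (λ iN Cn s x → (iN ⊗ (Cn ⊗ x ⊕ Cn ⊗ s ⊗ x)) ⊜ (iN ⊗ (Cn ⊗ (Κ 1# ⊕ s)) ⊗ x)) P.refl iN Cn s (X a) ⟩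
      iN * (Cn * (1# + s)) * X a
        ≡⟨ cong (λ z → iN * (Cn * ιR z) * X a) (P.sym (n∸r a a≤)) ⟩
      iN * (Cn * ιR (n ∸ a)) * X a
        ≡⟨ cong (λ z → iN * z * X a) (P.trans (P.sym (ιR-* (n C a) (n ∸ a)))
             (P.trans (ιR-cong (Binomial.absorb′ m a (ℕP.m≤n⇒m≤1+n a≤))) (ιR-* n (m C a)))) ⟩
      iN * (N * ιR (m C a)) * X a
        ≡⟨ cong (_* X a) (P.trans (P.sym (*-assoc iN N (ιR (m C a)))) (P.trans (cong (_* ιR (m C a)) iN-N) (*-identityˡ (ιR (m C a))))) ⟩
      ιR (m C a) * X a ∎)
      where
      Cn = ιR (n C a)
      s  = ιR (suc (M ∸ a))

  -- The convolution identity for K′ = M, where B_{M-1} = B_{2j+3} = 0.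
  U+U≡ : U + U ≡ N * Z
  U+U≡ = P.sym (convolution-identity M (B-odd j))

  -- 2m = d + 1.
  d : ℕ
  d = M ℕ.+ (suc M ℕ.+ 0)

  ratio : ιR (m ℕ.+ 2) * inv d ≡ h + iM
  ratio = begin
    ιR (m ℕ.+ 2) * inv d              ≡⟨ cong₂ _*_ (ιR-+ m 2) inv-2m ⟩
    (ιR m + ιR 2) * (h * iM)          ≡⟨ solve 4 (λ a b h i → ((a ⊕ b) ⊗ (h ⊗ i)) ⊜ (h ⊗ (a ⊗ i) ⊕ (b ⊗ h) ⊗ i)) P.refl (ιR m) (ιR 2) h iM ⟩
    h * (ιR m * iM) + (ιR 2 * h) * iM ≡⟨ cong₂ (λ x y → h * x + y * iM) (ιR-inv M) (ιR-inv 1) ⟩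
    h * 1# + 1# * iM                  ≡⟨ cong₂ _+_ (*-identityʳ h) (*-identityˡ iM) ⟩
    h + iM                            ∎
    where
    -- Inverses are unique: 2m · (h · iM) = 1 = 2m · inv d.
    inv-2m : inv d ≡ h * iM
    inv-2m = begin
      inv d                            ≡⟨ *-identityʳ (inv d) ⟨
      inv d * 1#                       ≡⟨ cong (inv d *_) (begin
        1#                             ≡⟨ cong₂ _*_ (ιR-inv 1) (ιR-inv M) ⟨
        (ιR 2 * h) * (ιR m * iM)       ≡⟨ solve 4 (λ a b h i → ((a ⊗ h) ⊗ (b ⊗ i)) ⊜ ((a ⊗ b) ⊗ (h ⊗ i))) P.refl (ιR 2) (ιR m) h iM ⟩
        (ιR 2 * ιR m) * (h * iM)       ≡⟨ cong (_* (h * iM)) (ιR-* 2 m) ⟨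
        ιR (suc d) * (h * iM)          ∎) ⟩
      inv d * (ιR (suc d) * (h * iM))  ≡⟨ *-assoc (inv d) (ιR (suc d)) (h * iM) ⟨
      (inv d * ιR (suc d)) * (h * iM)  ≡⟨ cong (_* (h * iM)) (P.trans (*-comm (inv d) (ιR (suc d))) (ιR-inv d)) ⟩
      1# * (h * iM)                    ≡⟨ *-identityˡ (h * iM) ⟩
      h * iM                           ∎

  -- iN · U = h Z, as 2 iN U = iN (U + U) = iN N Z = Z.
  iN-U : iN * U ≡ h * Z
  iN-U = begin
    iN * U             ≡⟨ solve 2 (λ iN U → (iN ⊗ U) ⊜ (Κ h ⊗ (iN ⊗ (U ⊕ U)))) P.refl iN U ⟩
    h * (iN * (U + U)) ≡⟨ cong (λ x → h * (iN * x)) U+U≡ ⟩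
    h * (iN * (N * Z)) ≡⟨ cong (h *_) (P.trans (P.sym (*-assoc iN N Z)) (P.trans (cong (_* Z) iN-N) (*-identityˡ Z))) ⟩
    h * Z              ∎
    where open import Tactic.RingSolver.Core.Expression using (Κ)

  iN-D : iN * D ≡ W + - (iN * U)
  iN-D = begin
    iN * D                          ≡⟨ solve 3 (λ iN U D → (iN ⊗ D) ⊜ ((iN ⊗ U ⊕ iN ⊗ D) ⊕ ⊝ (iN ⊗ U))) P.refl iN U D ⟩
    (iN * U + iN * D) + - (iN * U)  ≡⟨ cong (_+ - (iN * U)) (P.trans (P.sym (distribˡ iN U D)) (P.sym W≡)) ⟩
    W + - (iN * U)                  ∎

  -- With B₁ = -h and 2h = 1, the collapsed left-hand side equals -(h + iM) W + h² Z.
  closing : (ιR 2 * iN) * (- h * (N * iM) * W + - h * U + - h * h * D) + iN * U ≡ - ((h + iM) * W) + h * h * Z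
  closing = begin
    (ιR 2 * iN) * (- h * (N * iM) * W + - h * U + - h * h * D) + iN * U
      ≡⟨ solve 8 (λ two h iN iM N U D W →
           ((two ⊗ iN) ⊗ (⊝ h ⊗ (N ⊗ iM) ⊗ W ⊕ ⊝ h ⊗ U ⊕ ⊝ h ⊗ h ⊗ D) ⊕ iN ⊗ U)
           ⊜ (⊝ ((two ⊗ h) ⊗ ((iN ⊗ N) ⊗ iM ⊗ W ⊕ iN ⊗ U ⊕ h ⊗ (iN ⊗ D))) ⊕ iN ⊗ U))
           P.refl (ιR 2) h iN iM N U D W ⟩
    - ((ιR 2 * h) * ((iN * N) * iM * W + iN * U + h * (iN * D))) + iN * U
      ≡⟨ cong₂ (λ x y → - (x * (y * iM * W + iN * U + h * (iN * D))) + iN * U) (ιR-inv 1) iN-N ⟩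
    - (1# * (1# * iM * W + iN * U + h * (iN * D))) + iN * U
      ≡⟨ solve 5 (λ iN iM U D W → (⊝ (Κ 1# ⊗ (Κ 1# ⊗ iM ⊗ W ⊕ iN ⊗ U ⊕ Κ h ⊗ (iN ⊗ D))) ⊕ iN ⊗ U)
                                  ⊜ (⊝ (iM ⊗ W) ⊕ ⊝ (Κ h ⊗ (iN ⊗ D)))) P.refl iN iM U D W ⟩
    - (iM * W) + - (h * (iN * D))
      ≡⟨ cong (λ x → - (iM * W) + - (h * x)) iN-D ⟩
    - (iM * W) + - (h * (W + - (iN * U)))
      ≡⟨ solve 4 (λ iM iN U W → (⊝ (iM ⊗ W) ⊕ ⊝ (Κ h ⊗ (W ⊕ ⊝ (iN ⊗ U))))
                                ⊜ (⊝ ((Κ h ⊕ iM) ⊗ W) ⊕ Κ h ⊗ (iN ⊗ U))) P.refl iM iN U W ⟩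
    - ((h + iM) * W) + h * (iN * U)
      ≡⟨ cong (λ x → - ((h + iM) * W) + h * x) iN-U ⟩
    - ((h + iM) * W) + h * (h * Z)
      ≡⟨ cong (λ x → - ((h + iM) * W) + x) (*-assoc h h Z) ⟨
    - ((h + iM) * W) + h * h * Z ∎
    where open import Tactic.RingSolver.Core.Expression using (Κ)

  fraction : ∀ a d → (+ a) / suc d ≡ ιR a * inv d
  fraction a d = P.trans (/-ι a d) (cong (_* inv d) (ι≡ιR a))

  triple-form : sumTo m (λ r → sumTo (m ∸ r) (λ l → ((+ ((n C r) ℕ.* ((n ∸ r) C l))) / suc (m ∸ r)) * B r * B l * B (m ∸ r ∸ l)))
                ≡ triple
  triple-form = P.trans (P.sym (Σ≡sumTo m _)) (Σ-cong′ m (λ r → P.trans (P.sym (Σ≡sumTo (m ∸ r) _))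
                  (Σ-cong′ (m ∸ r) (λ l → cong (λ z → z * B r * B l * B (m ∸ r ∸ l)) (fraction ((n C r) ℕ.* ((n ∸ r) C l)) (m ∸ r))))))

  binomial-form : ∀ k → sumTo M (λ r → ι (k C r) * B r * B (M ∸ r)) ≡ Σ M (λ r → ιR (k C r) * X r)
  binomial-form k = P.trans (P.sym (Σ≡sumTo M _))
                      (Σ-cong′ M (λ r → P.trans (cong (λ z → z * B r * B (M ∸ r)) (ι≡ιR (k C r))) (*-assoc (ιR (k C r)) (B r) (B (M ∸ r)))))

  theorem :
    (+ 2 / suc m) * sumTo m (λ r → sumTo (m ∸ r) (λ l →
        ((+ ((suc m C r) ℕ.* ((suc m ∸ r) C l))) / suc (m ∸ r))
          * B r * B l * B (m ∸ r ∸ l)))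
    + (+ 1 / suc m) * sumTo (m ∸ 1) (λ r → ι (suc m C r) * B r * B (m ∸ 1 ∸ r))
    ≡
    - ((((+ (m ℕ.+ 2)) / (2 ℕ.* m)) {{m*n≢0 2 m}})
        * sumTo (m ∸ 1) (λ r → ι (m C r) * B r * B (m ∸ 1 ∸ r)))
    + (+ 1 / 4) * sumTo (m ∸ 1) (λ r → B r * B (m ∸ 1 ∸ r))
  theorem = begin
    _                                   ≡⟨ cong₂ _+_ (cong₂ _*_ (fraction 2 m) triple-form) (cong₂ _*_ one-over-N (binomial-form n)) ⟩
    (ιR 2 * iN) * triple + iN * U       ≡⟨ cong (λ t → (ιR 2 * iN) * t + iN * U) collapse ⟩
    (ιR 2 * iN) * (B 1 * (N * iM) * W + B 1 * U + B 1 * h * D) + iN * U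
                                        ≡⟨ closing ⟩
    - ((h + iM) * W) + h * h * Z        ≡⟨ cong₂ (λ x y → - x + h * h * y) (cong₂ _*_ coefficient (P.sym (binomial-form m))) (Σ≡sumTo M X) ⟩
    _                                   ∎
    where
    one-over-N : (+ 1) / suc m ≡ iN
    one-over-N = P.trans (fraction 1 m) (P.trans (cong (_* iN) (+-identityʳ 1#)) (*-identityˡ iN))
    coefficient : h + iM ≡ (+ (m ℕ.+ 2)) / suc d
    coefficient = P.trans (P.sym ratio) (P.sym (fraction (m ℕ.+ 2) d))

-- The rational operations are opened only here: above, the same symbols denote ring operations.
open import Data.Integer using (+_)
open import Data.Rational using (_+_; _*_; -_; _/_)
open import Data.Nat.Properties using (m*n≢0)

lemma2p2 : (m : ℕ) → .{{_ : NonZero m}} → m % 2 ≡ 1 → m ≢ 3 →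
    (+ 2 / suc m) * sumTo m (λ r → sumTo (m ∸ r) (λ l →
        ((+ ((suc m C r) ℕ.* ((suc m ∸ r) C l))) / suc (m ∸ r))
          * B r * B l * B (m ∸ r ∸ l)))
    + (+ 1 / suc m) * sumTo (m ∸ 1) (λ r → ι (suc m C r) * B r * B (m ∸ 1 ∸ r))
    ≡
    - ((((+ (m ℕ.+ 2)) / (2 ℕ.* m)) {{m*n≢0 2 m}})
        * sumTo (m ∸ 1) (λ r → ι (m C r) * B r * B (m ∸ 1 ∸ r)))
    + (+ 1 / 4) * sumTo (m ∸ 1) (λ r → B r * B (m ∸ 1 ∸ r))
lemma2p2 1 _ _ = P.refl
lemma2p2 3 _ m≢3 = ⊥-elim (m≢3 P.refl)
lemma2p2 (suc (suc (suc (suc (suc k))))) m-odd _ =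
  [ (λ { (j , P.refl) → Assembly.theorem j })
  , (λ { (j , P.refl) → ⊥-elim (0≢1 (P.trans (P.sym (Parity.even%2 j)) m-odd)) })
  ]′ (Parity.parity k)
  where
  0≢1 : 0 ≢ 1
  0≢1 ()
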